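{- Fix an integer $k \geq 4$. For a finite projective plane $\Pi$ of order $n$ with Levi graph $\Gamma_{\Pi}$, $$c_{2k}(\Gamma_{\Pi}) = \frac{1}{2k}n^{2k} + O(n^{2k-2}) \quad \text{as } n \to \infty.$$ Here the implied constant in $O(n^{2k-2})$ depends only on $k$, not on the particular plane $\Pi$.
   Context: For a finite projective plane $\Pi$ of order $n$, the Levi graph (point-line incidence graph) $\Gamma_{\Pi}$ is the bipartite graph whose two vertex classes are the set of points and the set of lines of $\Pi$, a point $P$ being adjacent to a line $\ell$ iff $P$ lies on $\ell$. For a graph $G$, $c_{2k}(G)$ denotes the number of cycles of length $2k$ in $G$ (as subgraphs). -}

module Defs where

open import Data.Nat using (ℕ; zero; suc; _+_; _*_; _/_)
open import Data.Bool using (Bool; true; false; _∧_; not)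
open import Data.Fin using (Fin)
open import Data.Fin.Properties using () renaming (_≟_ to _≟ᶠ_)
open import Data.Sum using (_⊎_; inj₁; inj₂)
open import Data.List using (List; []; _∷_; map; concatMap; filter; length; allFin; _++_)
open import Data.Bool.ListAction using (any)
open import Data.Product using (_×_; _,_; ∃-syntax)
open import Relation.Binary.PropositionalEquality using (_≡_; _≢_)
open import Relation.Nullary using (¬_)
open import Relation.Nullary.Decidable using (⌊_⌋)
open import Data.Bool.Properties using () renaming (_≟_ to _≟ᵇ_)

record ProjectivePlane (p l : ℕ) : Set where
  field
    I : Fin p → Fin l → Bool
    join      : ∀ (P Q : Fin p) → P ≢ Q → ∃[ ℓ ] (I P ℓ ≡ true × I Q ℓ ≡ true)
    join-uniq : ∀ (P Q : Fin p) → P ≢ Q → ∀ (ℓ m : Fin l) →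
                I P ℓ ≡ true → I Q ℓ ≡ true → I P m ≡ true → I Q m ≡ true → ℓ ≡ m
    meet      : ∀ (ℓ m : Fin l) → ℓ ≢ m → ∃[ P ] (I P ℓ ≡ true × I P m ≡ true)
    meet-uniq : ∀ (ℓ m : Fin l) → ℓ ≢ m → ∀ (P Q : Fin p) →
                I P ℓ ≡ true → I P m ≡ true → I Q ℓ ≡ true → I Q m ≡ true → P ≡ Q
    quad      : ∃[ a ] ∃[ b ] ∃[ c ] ∃[ d ]
                ( a ≢ b × a ≢ c × a ≢ d × b ≢ c × b ≢ d × c ≢ d
                × (∀ ℓ → ¬ (I a ℓ ≡ true × I b ℓ ≡ true × I c ℓ ≡ true))
                × (∀ ℓ → ¬ (I a ℓ ≡ true × I b ℓ ≡ true × I d ℓ ≡ true))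
                × (∀ ℓ → ¬ (I a ℓ ≡ true × I c ℓ ≡ true × I d ℓ ≡ true))
                × (∀ ℓ → ¬ (I b ℓ ≡ true × I c ℓ ≡ true × I d ℓ ≡ true)))

open ProjectivePlane public

pointsOn : ∀ {p l} → ProjectivePlane p l → Fin l → ℕ
pointsOn {p} Π ℓ = length (filter (λ P → I Π P ℓ ≟ᵇ true) (allFin p))

HasOrder : ∀ {p l} → ProjectivePlane p l → ℕ → Set
HasOrder {p} {l} Π n = ∀ (ℓ : Fin l) → pointsOn Π ℓ ≡ suc n

LeviV : ℕ → ℕ → Set
LeviV p l = Fin p ⊎ Fin l

leviVertices : ∀ p l → List (LeviV p l)
leviVertices p l = map inj₁ (allFin p) ++ map inj₂ (allFin l)

leviAdj : ∀ {p l} → ProjectivePlane p l → LeviV p l → LeviV p l → Bool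
leviAdj Π (inj₁ P) (inj₂ ℓ) = I Π P ℓ
leviAdj Π (inj₂ ℓ) (inj₁ P) = I Π P ℓ
leviAdj Π _ _ = false

eqV : ∀ {p l} → LeviV p l → LeviV p l → Bool
eqV (inj₁ x) (inj₁ y) = ⌊ x ≟ᶠ y ⌋
eqV (inj₂ x) (inj₂ y) = ⌊ x ≟ᶠ y ⌋
eqV _ _ = false

allLists : {A : Set} → List A → ℕ → List (List A)
allLists vs zero    = [] ∷ []
allLists vs (suc m) = concatMap (λ v → map (v ∷_) (allLists vs m)) vs

distinct : {A : Set} → (A → A → Bool) → List A → Bool
distinct eq []       = true
distinct eq (x ∷ xs) = not (any (eq x) xs) ∧ distinct eq xs

pathTo : {A : Set} → (A → A → Bool) → A → List A → Bool
pathTo adj first []           = false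
pathTo adj first (x ∷ [])     = adj x first
pathTo adj first (x ∷ y ∷ ys) = adj x y ∧ pathTo adj first (y ∷ ys)

closedWalk : {A : Set} → (A → A → Bool) → List A → Bool
closedWalk adj []       = false
closedWalk adj (x ∷ xs) = pathTo adj x (x ∷ xs)

-- number of sequences (v₀,…,v_{m-1}) of distinct vertices with v_i ~ v_{i+1}
-- (indices mod m): each m-cycle (m ≥ 3) corresponds to exactly 2m of them.
cycleSeqCount : {A : Set} → List A → (A → A → Bool) → (A → A → Bool) → ℕ → ℕ
cycleSeqCount vs eq adj m =
  length (filter (λ s → (distinct eq s ∧ closedWalk adj s) ≟ᵇ true) (allLists vs m))

cycleCount : {A : Set} → List A → (A → A → Bool) → (A → A → Bool) → ℕ → ℕ
cycleCount vs eq adj zero    = 0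
cycleCount vs eq adj (suc m) = cycleSeqCount vs eq adj (suc m) / (2 * suc m)

c[_]Levi : ℕ → ∀ {p l} → ProjectivePlane p l → ℕ
c[ m ]Levi {p} {l} Π = cycleCount (leviVertices p l) eqV (leviAdj Π) m

-- The 2k·c₂ₖ cycle sequences (2k distinct vertices forming a closed walk) are counted by cutting
-- them into a non-backtracking walk w₀ w₁ … u w with 2k − 4 edges and three closing vertices
-- c₁ c₂ c₃. The Levi graph has v = 2(n² + n + 1) vertices, is bipartite and (n + 1)-regular, and
-- two distinct vertices have at most one common neighbour, exactly one if they lie on the same
-- side. There are v(n + 1)n²ᵏ⁻⁵ such walks. Given one, c₁ is a neighbour of w other than u and
-- the common neighbour of w and w₀, c₂ a neighbour of c₁ other than w and the common neighbour of
-- c₁ and w₁, and c₃ is then the common neighbour of c₂ and w₀: about (n − 1)² closings, with an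
-- error of order n only when u ~ w₀ or w ~ w₁, which happens for O(n²ᵏ⁻⁴) walks. Conversely each
-- such walk with w ≠ w₀ and each closing form a closed non-backtracking walk; those that are not
-- cycles split at a repeated vertex into two shorter closed ones, of which there are O(n²ᵏ⁻⁴)
-- pairs. Since (n − 1)²(n + 1)(n² + n + 1) = n⁵ − n³ − n² + 1, both bounds read 2n²ᵏ + O(n²ᵏ⁻²).

{-# OPTIONS --safe #-}
module Submission where

open import Defs
open import Data.Bool using (Bool; true; false; _∧_; _∨_; not; T)
open import Data.Bool.Properties using (T-∧; T-∨; T-≡; not-involutive; ∧-comm; ∧-zeroʳ; ∧-identityʳ) renaming (_≟_ to _≟ᵇ_)
open import Data.Bool.ListAction using (any)
open import Data.Empty using (⊥-elim)
open import Data.Fin using (Fin) renaming (zero to fzero; suc to fsuc)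
open import Data.Fin.Properties using () renaming (_≟_ to _≟ᶠ_)
open import Data.List using (List; []; _∷_; map; concatMap; length; _++_; allFin; filter)
open import Data.List.Properties using (++-assoc; length-++; length-map; map-tabulate; length-tabulate)
open import Data.List.Relation.Unary.All using (All; []; _∷_; universal)
import Data.List.Relation.Unary.All.Properties as All
open import Data.Nat using (ℕ; zero; suc; _+_; _*_; _∸_; _^_; _≤_; _<_; z≤n; s≤s; _/_)
open import Data.Nat.DivMod using (m/n*n≤m; m≡m%n+[m/n]*n; m%n<n)
open import Data.Nat.Properties
open import Algebra.Properties.CommutativeSemigroup +-commutativeSemigroup using (interchange)
open import Data.Nat.Tactic.RingSolver using (solve-∀)
open import Data.Product using (_×_; _,_; proj₁; proj₂; ∃-syntax)
open import Data.Sum using (_⊎_; inj₁; inj₂)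
open import Data.Unit using (tt)
open import Function using (_∘_; id; Equivalence)
open import Relation.Binary.PropositionalEquality
  using (_≡_; _≢_; refl; sym; trans; cong; cong₂; subst; module ≡-Reasoning)
open import Relation.Nullary using (¬_; yes; no)
open import Relation.Nullary.Decidable using (⌊_⌋; T?; toWitness; fromWitness)

∑ : {A : Set} → List A → (A → ℕ) → ℕ
∑ []       f = 0
∑ (x ∷ xs) f = f x + ∑ xs f

infix 5 ∑
syntax ∑ xs (λ x → e) = ∑[ x ∈ xs ] e

module _ {A : Set} where

  ∑-++ : ∀ xs ys (f : A → ℕ) → ∑ (xs ++ ys) f ≡ ∑ xs f + ∑ ys f
  ∑-++ []       ys f = refl
  ∑-++ (x ∷ xs) ys f = trans (cong (f x +_) (∑-++ xs ys f)) (sym (+-assoc (f x) _ _))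

  ∑-cong : ∀ xs {f g : A → ℕ} → (∀ x → f x ≡ g x) → ∑ xs f ≡ ∑ xs g
  ∑-cong []       f≡g = refl
  ∑-cong (x ∷ xs) f≡g = cong₂ _+_ (f≡g x) (∑-cong xs f≡g)

  ∑-mono : ∀ xs {f g : A → ℕ} → (∀ x → f x ≤ g x) → ∑ xs f ≤ ∑ xs g
  ∑-mono []       f≤g = z≤n
  ∑-mono (x ∷ xs) f≤g = +-mono-≤ (f≤g x) (∑-mono xs f≤g)

  ∑-mono-All : ∀ {P : A → Set} xs {f g : A → ℕ} →
               All P xs → (∀ x → P x → f x ≤ g x) → ∑ xs f ≤ ∑ xs g
  ∑-mono-All []       []         f≤g = z≤n
  ∑-mono-All (x ∷ xs) (px ∷ pxs) f≤g = +-mono-≤ (f≤g x px) (∑-mono-All xs pxs f≤g)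

  ∑-+ : ∀ xs (f g : A → ℕ) → ∑[ x ∈ xs ] f x + g x ≡ ∑ xs f + ∑ xs g
  ∑-+ []       f g = refl
  ∑-+ (x ∷ xs) f g =
    trans (cong (f x + g x +_) (∑-+ xs f g)) (interchange (f x) (g x) (∑ xs f) (∑ xs g))

  ∑-*ˡ : ∀ xs c (f : A → ℕ) → ∑[ x ∈ xs ] c * f x ≡ c * ∑ xs f
  ∑-*ˡ []       c f = sym (*-zeroʳ c)
  ∑-*ˡ (x ∷ xs) c f = trans (cong (c * f x +_) (∑-*ˡ xs c f)) (sym (*-distribˡ-+ c (f x) _))

  ∑-*ʳ : ∀ xs c (f : A → ℕ) → ∑[ x ∈ xs ] f x * c ≡ ∑ xs f * c
  ∑-*ʳ xs c f = trans (∑-cong xs (λ x → *-comm (f x) c)) (trans (∑-*ˡ xs c f) (*-comm c _))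

  ∑-const : ∀ (xs : List A) c → ∑[ x ∈ xs ] c ≡ length xs * c
  ∑-const []       c = refl
  ∑-const (x ∷ xs) c = cong (c +_) (∑-const xs c)

  ∑-zero : ∀ (xs : List A) → ∑[ x ∈ xs ] 0 ≡ 0
  ∑-zero xs = trans (∑-const xs 0) (*-zeroʳ (length xs))

  ∑-map : ∀ {B : Set} (g : B → A) xs (f : A → ℕ) → ∑ (map g xs) f ≡ ∑[ x ∈ xs ] f (g x)
  ∑-map g []       f = refl
  ∑-map g (x ∷ xs) f = cong (f (g x) +_) (∑-map g xs f)

  ∑-concatMap : ∀ {B : Set} (g : B → List A) xs (f : A → ℕ) →
                ∑ (concatMap g xs) f ≡ ∑[ x ∈ xs ] ∑ (g x) f
  ∑-concatMap g []       f = refl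
  ∑-concatMap g (x ∷ xs) f =
    trans (∑-++ (g x) (concatMap g xs) f) (cong (∑ (g x) f +_) (∑-concatMap g xs f))

∑-comm : ∀ {A B : Set} xs ys (f : A → B → ℕ) →
         ∑[ x ∈ xs ] ∑[ y ∈ ys ] f x y ≡ ∑[ y ∈ ys ] ∑[ x ∈ xs ] f x y
∑-comm []       ys f = sym (∑-zero ys)
∑-comm (x ∷ xs) ys f =
  trans (cong (∑ ys (f x) +_) (∑-comm xs ys f)) (sym (∑-+ ys (f x) (λ y → ∑[ x ∈ xs ] f x y)))

∑< : ℕ → (ℕ → ℕ) → ℕ
∑< zero    f = 0
∑< (suc j) f = f 0 + ∑< j (f ∘ suc)

infix 5 ∑<
syntax ∑< j (λ d → e) = ∑[ d < j ] e

∑<-cong : ∀ j {f g : ℕ → ℕ} → (∀ d → f d ≡ g d) → ∑< j f ≡ ∑< j g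
∑<-cong zero    f≡g = refl
∑<-cong (suc j) f≡g = cong₂ _+_ (f≡g 0) (∑<-cong j (f≡g ∘ suc))

∑<-≤ : ∀ j {f : ℕ → ℕ} {B} → (∀ d → d < j → f d ≤ B) → ∑< j f ≤ j * B
∑<-≤ zero    f≤B = z≤n
∑<-≤ (suc j) f≤B = +-mono-≤ (f≤B 0 (s≤s z≤n)) (∑<-≤ j (λ d d<j → f≤B (suc d) (s≤s d<j)))

∑-∑< : ∀ {A : Set} xs j (f : A → ℕ → ℕ) → ∑[ x ∈ xs ] ∑< j (f x) ≡ ∑[ d < j ] ∑[ x ∈ xs ] f x d
∑-∑< xs zero    f = ∑-zero xs
∑-∑< xs (suc j) f =
  trans (∑-+ xs (λ x → f x 0) (λ x → ∑< j (f x ∘ suc)))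
        (cong ((∑[ x ∈ xs ] f x 0) +_) (∑-∑< xs j (λ x → f x ∘ suc)))

𝟙 : Bool → ℕ
𝟙 true  = 1
𝟙 false = 0

∧-intro : ∀ {a b} → T a → T b → T (a ∧ b)
∧-intro p q = Equivalence.from T-∧ (p , q)

∧-elim : ∀ a {b} → T (a ∧ b) → T a × T b
∧-elim a = Equivalence.to T-∧

not-intro : ∀ {a} → ¬ T a → T (not a)
not-intro {true}  ¬a = ¬a tt
not-intro {false} ¬a = tt

not-elim : ∀ {a} → T (not a) → ¬ T a
not-elim {true} ()

𝟙-true : ∀ {a} → T a → 𝟙 a ≡ 1
𝟙-true {true} _ = refl

𝟙-false : ∀ {a} → ¬ T a → 𝟙 a ≡ 0
𝟙-false {true}  ¬a = ⊥-elim (¬a tt)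
𝟙-false {false} ¬a = refl

𝟙-pos : ∀ {a} → T a → 1 ≤ 𝟙 a
𝟙-pos ta = ≤-reflexive (sym (𝟙-true ta))

𝟙≤1 : ∀ a → 𝟙 a ≤ 1
𝟙≤1 true  = s≤s z≤n
𝟙≤1 false = z≤n

𝟙-∧ : ∀ a b → 𝟙 (a ∧ b) ≡ 𝟙 a * 𝟙 b
𝟙-∧ true  b = sym (+-identityʳ (𝟙 b))
𝟙-∧ false b = refl

𝟙-mono : ∀ {a b} → (T a → T b) → 𝟙 a ≤ 𝟙 b
𝟙-mono {false}        a⇒b = z≤n
𝟙-mono {true} {true}  a⇒b = ≤-refl
𝟙-mono {true} {false} a⇒b = ⊥-elim (a⇒b tt)

𝟙-≤-* : ∀ {a b c} → (T a → T b × T c) → 𝟙 a ≤ 𝟙 b * 𝟙 c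
𝟙-≤-* {a} {b} {c} a⇒bc =
  subst (𝟙 a ≤_) (𝟙-∧ b c) (𝟙-mono (λ ta → ∧-intro (proj₁ (a⇒bc ta)) (proj₂ (a⇒bc ta))))

𝟙-*-≤ : ∀ {a b c} → (T b → T c → T a) → 𝟙 b * 𝟙 c ≤ 𝟙 a
𝟙-*-≤ {a} {b} {c} bc⇒a =
  subst (_≤ 𝟙 a) (𝟙-∧ b c) (𝟙-mono (λ tbc → bc⇒a (proj₁ (∧-elim b tbc)) (proj₂ (∧-elim b tbc))))

𝟙*𝟙-≤ : ∀ a b {N} → (T a → T b → 1 ≤ N) → 𝟙 a * 𝟙 b ≤ N
𝟙*𝟙-≤ true  true  ab⇒N = ab⇒N tt tt
𝟙*𝟙-≤ true  false ab⇒N = z≤n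
𝟙*𝟙-≤ false b     ab⇒N = z≤n

𝟙-split : ∀ a b → 𝟙 a ≡ 𝟙 (a ∧ not b) + 𝟙 (a ∧ b)
𝟙-split false b     = refl
𝟙-split true  true  = refl
𝟙-split true  false = refl

𝟙-∧-∨-≤ : ∀ a b c → 𝟙 (a ∧ (b ∨ c)) ≤ 𝟙 b * 𝟙 a + 𝟙 (a ∧ c)
𝟙-∧-∨-≤ false b     c = z≤n
𝟙-∧-∨-≤ true  true  c = s≤s z≤n
𝟙-∧-∨-≤ true  false c = ≤-refl

𝟙-∧-not-∧-≤ : ∀ a b c → 𝟙 (a ∧ not (not b ∧ c)) ≤ 𝟙 (a ∧ b) + 𝟙 (a ∧ not c)
𝟙-∧-not-∧-≤ false b     c     = z≤n
𝟙-∧-not-∧-≤ true  true  c     = s≤s z≤n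
𝟙-∧-not-∧-≤ true  false true  = z≤n
𝟙-∧-not-∧-≤ true  false false = ≤-refl

𝟙*-mono : ∀ a {x y} → (T a → x ≤ y) → 𝟙 a * x ≤ 𝟙 a * y
𝟙*-mono true  x≤y = *-monoʳ-≤ 1 (x≤y tt)
𝟙*-mono false x≤y = z≤n

𝟙-cover : ∀ {a b c d} → (T a → T b ⊎ T c ⊎ T d) → 𝟙 a ≤ 𝟙 b + (𝟙 c + 𝟙 d)
𝟙-cover {false} cover = z≤n
𝟙-cover {true} {b} {c} {d} cover with cover tt
... | inj₁ tb        = ≤-trans (𝟙-pos tb) (m≤m+n (𝟙 b) _)
... | inj₂ (inj₁ tc) = ≤-trans (𝟙-pos tc) (≤-trans (m≤m+n (𝟙 c) (𝟙 d)) (m≤n+m _ (𝟙 b)))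
... | inj₂ (inj₂ td) = ≤-trans (𝟙-pos td) (≤-trans (m≤n+m (𝟙 d) (𝟙 c)) (m≤n+m _ (𝟙 b)))

length-filter : ∀ {A : Set} (P : A → Bool) xs →
                length (filter (λ x → P x ≟ᵇ true) xs) ≡ ∑[ x ∈ xs ] 𝟙 (P x)
length-filter P []       = refl
length-filter P (x ∷ xs) with P x
... | true  = cong suc (length-filter P xs)
... | false = length-filter P xs

∑-𝟙≡0⊎witness : ∀ {A : Set} (P : A → Bool) xs → ∑[ x ∈ xs ] 𝟙 (P x) ≡ 0 ⊎ ∃[ x ] T (P x)
∑-𝟙≡0⊎witness P []       = inj₁ refl
∑-𝟙≡0⊎witness P (x ∷ xs) with P x in px
... | true  = inj₂ (x , subst T (sym px) tt)
... | false = ∑-𝟙≡0⊎witness P xs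

+-*-+-≤ : ∀ {x m a b} → x ≤ m → b ≤ 1 → (x + a) * (x + b) ≤ x * x + suc m * (a + b)
+-*-+-≤ {x} {m} {a} {b} x≤m b≤1 = begin
  (x + a) * (x + b)                   ≡⟨ expand x a b ⟩
  x * x + (x * (a + b) + a * b)       ≤⟨ +-monoʳ-≤ (x * x) (+-mono-≤ (*-monoˡ-≤ (a + b) x≤m) ab≤a+b) ⟩
  x * x + (m * (a + b) + (a + b))     ≡⟨ cong (x * x +_) (+-comm (m * (a + b)) (a + b)) ⟩
  x * x + suc m * (a + b)             ∎
  where
  open ≤-Reasoning
  expand : ∀ x a b → (x + a) * (x + b) ≡ x * x + (x * (a + b) + a * b)
  expand = solve-∀
  ab≤a+b : a * b ≤ a + b
  ab≤a+b = ≤-trans (*-monoʳ-≤ a b≤1) (≤-trans (≤-reflexive (*-identityʳ a)) (m≤m+n a b))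

repeat-exponent : ∀ {i j d} → i < j → d < j ∸ suc i → d + ((j ∸ suc i ∸ suc d) + i) ∸ 2 ≡ j ∸ 4
repeat-exponent {i} {j} {d} i<j d<j-i = begin
  d + (e + i) ∸ 2       ≡⟨ cong (_∸ 2) (rearrange d e i) ⟩
  i + (d + e) ∸ 2       ≡⟨ cong (_∸ 3) (+-suc i (d + e)) ⟨
  i + suc (d + e) ∸ 3   ≡⟨ cong (λ m → i + m ∸ 3) (m+[n∸m]≡n d<j-i) ⟩
  i + (j ∸ suc i) ∸ 3   ≡⟨ cong (_∸ 4) (m+[n∸m]≡n i<j) ⟩
  j ∸ 4                 ∎
  where
  open ≡-Reasoning
  e : ℕ
  e = j ∸ suc i ∸ suc d
  rearrange : ∀ d e i → d + (e + i) ≡ i + (d + e)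
  rearrange = solve-∀

module Sequences {X : Set} (Vs : List X) where

  Seqs : ℕ → List (List X)
  Seqs = allLists Vs

  ∑-Seqs-zero : ∀ (f : List X → ℕ) → ∑ (Seqs 0) f ≡ f []
  ∑-Seqs-zero f = +-identityʳ (f [])

  ∑-Seqs-suc : ∀ m (f : List X → ℕ) → ∑ (Seqs (suc m)) f ≡ ∑[ x ∈ Vs ] ∑[ t ∈ Seqs m ] f (x ∷ t)
  ∑-Seqs-suc m f =
    trans (∑-concatMap (λ x → map (x ∷_) (Seqs m)) Vs f) (∑-cong Vs (λ x → ∑-map (x ∷_) (Seqs m) f))

  ∑-Seqs-+ : ∀ a b (f : List X → ℕ) → ∑ (Seqs (a + b)) f ≡ ∑[ s ∈ Seqs a ] ∑[ t ∈ Seqs b ] f (s ++ t)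
  ∑-Seqs-+ zero    b f = sym (∑-Seqs-zero (λ s → ∑[ t ∈ Seqs b ] f (s ++ t)))
  ∑-Seqs-+ (suc a) b f = begin
    ∑ (Seqs (suc a + b)) f
      ≡⟨ ∑-Seqs-suc (a + b) f ⟩
    ∑[ x ∈ Vs ] ∑[ t ∈ Seqs (a + b) ] f (x ∷ t)
      ≡⟨ ∑-cong Vs (λ x → ∑-Seqs-+ a b (f ∘ (x ∷_))) ⟩
    ∑[ x ∈ Vs ] ∑[ s ∈ Seqs a ] ∑[ t ∈ Seqs b ] f (x ∷ s ++ t)
      ≡⟨ ∑-Seqs-suc a (λ s → ∑[ t ∈ Seqs b ] f (s ++ t)) ⟨
    ∑[ s ∈ Seqs (suc a) ] ∑[ t ∈ Seqs b ] f (s ++ t) ∎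
    where open ≡-Reasoning

  ∑-Seqs-snoc : ∀ r (f : List X → ℕ) → ∑ (Seqs (suc r)) f ≡ ∑[ s ∈ Seqs r ] ∑[ u ∈ Vs ] f (s ++ u ∷ [])
  ∑-Seqs-snoc zero    f =
    trans (∑-Seqs-suc 0 f)
          (trans (∑-cong Vs (λ u → ∑-Seqs-zero (λ t → f (u ∷ t))))
                 (sym (∑-Seqs-zero (λ s → ∑[ u ∈ Vs ] f (s ++ u ∷ [])))))
  ∑-Seqs-snoc (suc r) f =
    trans (∑-Seqs-suc (suc r) f)
          (trans (∑-cong Vs (λ x → ∑-Seqs-snoc r (f ∘ (x ∷_))))
                 (sym (∑-Seqs-suc r (λ s → ∑[ u ∈ Vs ] f (s ++ u ∷ [])))))

  Seqs-length : ∀ m → All (λ s → length s ≡ m) (Seqs m)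
  Seqs-length zero    = refl ∷ []
  Seqs-length (suc m) =
    All.concat⁺ (All.map⁺ (universal (λ x → All.gmap⁺ (cong suc) (Seqs-length m)) Vs))

  ∑-Seqs-mono : ∀ m {f g : List X → ℕ} →
                (∀ s → length s ≡ m → f s ≤ g s) → ∑ (Seqs m) f ≤ ∑ (Seqs m) g
  ∑-Seqs-mono m = ∑-mono-All (Seqs m) (Seqs-length m)

module Counting {X : Set} (Vs : List X) (eq : X → X → Bool)
  (eq-sound : ∀ x y → T (eq x y) → x ≡ y)
  (eq-refl : ∀ x → T (eq x x))
  (occurs-once : ∀ a → ∑[ x ∈ Vs ] 𝟙 (eq a x) ≡ 1)
  where

  count : (X → Bool) → ℕ
  count P = ∑[ x ∈ Vs ] 𝟙 (P x)

  ≡⇒eq : ∀ {x y} → x ≡ y → T (eq x y)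
  ≡⇒eq {x} refl = eq-refl x

  not-eq⇒≢ : ∀ {x y} → T (not (eq x y)) → x ≢ y
  not-eq⇒≢ ne x≡y = not-elim ne (≡⇒eq x≡y)

  ≢⇒not-eq : ∀ {x y} → x ≢ y → T (not (eq x y))
  ≢⇒not-eq {x} {y} x≢y = not-intro (x≢y ∘ eq-sound x y)

  ∑-select : ∀ a (g : X → ℕ) → ∑[ x ∈ Vs ] 𝟙 (eq a x) * g x ≡ g a
  ∑-select a g = begin
    ∑[ x ∈ Vs ] 𝟙 (eq a x) * g x  ≡⟨ ∑-cong Vs at-a ⟩
    ∑[ x ∈ Vs ] 𝟙 (eq a x) * g a  ≡⟨ ∑-*ʳ Vs (g a) (𝟙 ∘ eq a) ⟩
    count (eq a) * g a            ≡⟨ cong (_* g a) (occurs-once a) ⟩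
    1 * g a                       ≡⟨ *-identityˡ (g a) ⟩
    g a                           ∎
    where
    open ≡-Reasoning
    at-a : ∀ x → 𝟙 (eq a x) * g x ≡ 𝟙 (eq a x) * g a
    at-a x with eq a x in a=x
    ... | true  = cong (λ y → 1 * g y) (sym (eq-sound a x (subst T (sym a=x) tt)))
    ... | false = refl

  count-zero : ∀ P → (∀ x → ¬ T (P x)) → count P ≡ 0
  count-zero P none = trans (∑-cong Vs (λ x → 𝟙-false (none x))) (∑-zero Vs)

  count-≤1 : ∀ P → (∀ x y → T (P x) → T (P y) → x ≡ y) → count P ≤ 1
  count-≤1 P unique with ∑-𝟙≡0⊎witness P Vs
  ... | inj₁ none       = subst (_≤ 1) (sym none) z≤n
  ... | inj₂ (x₀ , px₀) =
    ≤-trans (∑-mono Vs (λ x → 𝟙-mono (λ px → ≡⇒eq (unique x₀ x px₀ px)))) (≤-reflexive (occurs-once x₀))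

  count-≤-𝟙 : ∀ P b → (∀ x → T (P x) → T b) → (∀ x y → T (P x) → T (P y) → x ≡ y) →
              count P ≤ 𝟙 b
  count-≤-𝟙 P true  _    unique = count-≤1 P unique
  count-≤-𝟙 P false P⇒b _      = ≤-reflexive (count-zero P P⇒b)

  count-remove : ∀ P a → T (P a) → count P ≡ suc (count (λ x → P x ∧ not (eq a x)))
  count-remove P a pa = begin
    count P
      ≡⟨ ∑-cong Vs split ⟩
    ∑[ x ∈ Vs ] 𝟙 (eq a x) + 𝟙 (P x ∧ not (eq a x))
      ≡⟨ ∑-+ Vs (𝟙 ∘ eq a) _ ⟩
    count (eq a) + count (λ x → P x ∧ not (eq a x))
      ≡⟨ cong (_+ count (λ x → P x ∧ not (eq a x))) (occurs-once a) ⟩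
    suc (count (λ x → P x ∧ not (eq a x))) ∎
    where
    open ≡-Reasoning
    split : ∀ x → 𝟙 (P x) ≡ 𝟙 (eq a x) + 𝟙 (P x ∧ not (eq a x))
    split x with eq a x in a=x
    ... | true with eq-sound a x (subst T (sym a=x) tt)
    ...   | refl with P a
    ...     | true = refl
    split x | false with P x
    ... | true  = refl
    ... | false = refl

  count-pos : ∀ P a → T (P a) → 1 ≤ count P
  count-pos P a pa = subst (1 ≤_) (sym (count-remove P a pa)) (s≤s z≤n)

  count-unique : ∀ R a → T (R a) → (∀ b → T (R b) → b ≡ a) → count R ≡ 1
  count-unique R a ra unique = trans (∑-cong Vs same) (occurs-once a)
    where
    same : ∀ b → 𝟙 (R b) ≡ 𝟙 (eq a b)
    same b with T? (R b)
    ... | yes rb = trans (𝟙-true rb) (sym (𝟙-true (≡⇒eq (sym (unique b rb)))))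
    ... | no ¬rb = trans (𝟙-false ¬rb) (sym (𝟙-false (λ a=b → ¬rb (subst (T ∘ R) (eq-sound a b a=b) ra))))

-- Levi graphs of projective planes of order n: bipartite, (n + 1)-regular, girth 6, diameter 3.
module GeneralizedTriangle
  {X : Set} (Vs : List X) (eq adj : X → X → Bool) (side : X → Bool) (n : ℕ)
  (eq-sound : ∀ x y → T (eq x y) → x ≡ y)
  (eq-refl : ∀ x → T (eq x x))
  (occurs-once : ∀ a → ∑[ x ∈ Vs ] 𝟙 (eq a x) ≡ 1)
  (degree : ∀ x → ∑[ y ∈ Vs ] 𝟙 (adj x y) ≡ suc n)
  (adj-sym : ∀ x y → adj x y ≡ adj y x)
  (adj-side : ∀ x y → T (adj x y) → side y ≡ not (side x))
  (common-unique : ∀ x y z w → x ≢ y →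
                   T (adj x z) → T (adj y z) → T (adj x w) → T (adj y w) → z ≡ w)
  (common-exists : ∀ x y → x ≢ y → side x ≡ side y → ∃[ z ] (T (adj x z) × T (adj y z)))
  where

  open Sequences Vs public
  open Counting Vs eq eq-sound eq-refl occurs-once public

  v : ℕ
  v = length Vs

  adj-flip : ∀ {x y} → T (adj x y) → T (adj y x)
  adj-flip {x} {y} = subst T (adj-sym x y)

  degree-to : ∀ x → ∑[ y ∈ Vs ] 𝟙 (adj y x) ≡ suc n
  degree-to x = trans (∑-cong Vs (λ y → cong 𝟙 (adj-sym y x))) (degree x)

  adj-irrefl : ∀ x → ¬ T (adj x x)
  adj-irrefl x x~x with side x | adj-side x x x~x
  ... | true  | ()
  ... | false | ()

  side-2step : ∀ {x y z} → T (adj x y) → T (adj y z) → side z ≡ side x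
  side-2step {x} {y} {z} x~y y~z =
    trans (adj-side y z y~z) (trans (cong not (adj-side x y x~y)) (not-involutive (side x)))

  degree-without : ∀ c a → T (adj c a) → count (λ x → adj c x ∧ not (eq a x)) ≡ n
  degree-without c a c~a = suc-injective (trans (sym (count-remove (adj c) a c~a)) (degree c))

  degree-without₂ : ∀ c a b → T (adj c a) → T (adj c b) → a ≢ b →
                    count (λ x → (adj c x ∧ not (eq a x)) ∧ not (eq b x)) ≡ n ∸ 1
  degree-without₂ c a b c~a c~b a≢b =
    cong (_∸ 1) (trans (sym (count-remove _ b (∧-intro c~b (≢⇒not-eq a≢b)))) (degree-without c a c~a))

  nb : X → List X → Bool
  nb a []      = true
  nb a (c ∷ _) = not (eq a c)

  nbWalk : List X → Bool
  nbWalk []          = true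
  nbWalk (a ∷ [])    = true
  nbWalk (a ∷ b ∷ r) = adj a b ∧ (nb a r ∧ nbWalk (b ∷ r))

  walk : List X → Bool
  walk []          = true
  walk (a ∷ [])    = true
  walk (a ∷ b ∷ r) = adj a b ∧ walk (b ∷ r)

  -- s ++ s has no backtracking iff s is a closed walk without backtracking, also where it closes.
  closedNB : List X → Bool
  closedNB s = nbWalk (s ++ s)

  isCycleSeq : List X → Bool
  isCycleSeq s = distinct eq s ∧ closedWalk adj s

  nbWalk-adj : ∀ a b r → T (nbWalk (a ∷ b ∷ r)) → T (adj a b)
  nbWalk-adj a b r p = proj₁ (∧-elim (adj a b) p)

  nbWalk-nb : ∀ a b r → T (nbWalk (a ∷ b ∷ r)) → T (nb a r)
  nbWalk-nb a b r p = proj₁ (∧-elim (nb a r) (proj₂ (∧-elim (adj a b) p)))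

  nbWalk-tail : ∀ a r → T (nbWalk (a ∷ r)) → T (nbWalk r)
  nbWalk-tail a []      p = tt
  nbWalk-tail a (b ∷ r) p = proj₂ (∧-elim (nb a r) (proj₂ (∧-elim (adj a b) p)))

  nbWalk-∷ : ∀ {a b} r → T (adj a b) → T (nb a r) → T (nbWalk (b ∷ r)) → T (nbWalk (a ∷ b ∷ r))
  nbWalk-∷ r a~b a≁r p = ∧-intro a~b (∧-intro a≁r p)

  nbWalk-suffix : ∀ l r → T (nbWalk (l ++ r)) → T (nbWalk r)
  nbWalk-suffix []      r p = p
  nbWalk-suffix (a ∷ l) r p = nbWalk-suffix l r (nbWalk-tail a (l ++ r) p)

  nbWalk-prefix : ∀ l r → T (nbWalk (l ++ r)) → T (nbWalk l)
  nbWalk-prefix []               r p = tt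
  nbWalk-prefix (a ∷ [])         r p = tt
  nbWalk-prefix (a ∷ b ∷ [])     r p = nbWalk-∷ [] (nbWalk-adj a b r p) tt tt
  nbWalk-prefix (a ∷ b ∷ c ∷ l) r p =
    nbWalk-∷ (c ∷ l) (nbWalk-adj a b (c ∷ l ++ r) p) (nbWalk-nb a b (c ∷ l ++ r) p)
             (nbWalk-prefix (b ∷ c ∷ l) r (nbWalk-tail a (b ∷ c ∷ l ++ r) p))

  nbWalk-infix : ∀ l m r → T (nbWalk (l ++ m ++ r)) → T (nbWalk m)
  nbWalk-infix l m r p = nbWalk-prefix m r (nbWalk-suffix l (m ++ r) p)

  -- Each turn of the glued walk is a turn of one of the pieces, as they share the edge x y.
  nbWalk-glue : ∀ l x y r → T (nbWalk (l ++ x ∷ y ∷ [])) → T (nbWalk (x ∷ y ∷ r)) →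
                T (nbWalk (l ++ x ∷ y ∷ r))
  nbWalk-glue []          x y r p q = q
  nbWalk-glue (a ∷ [])    x y r p q =
    nbWalk-∷ (y ∷ r) (nbWalk-adj a x (y ∷ []) p) (nbWalk-nb a x (y ∷ []) p) q
  nbWalk-glue (a ∷ b ∷ l) x y r p q =
    nbWalk-∷ (l ++ x ∷ y ∷ r) (nbWalk-adj a b (l ++ x ∷ y ∷ []) p)
             (subst T (nb-head l) (nbWalk-nb a b (l ++ x ∷ y ∷ []) p))
             (nbWalk-glue (b ∷ l) x y r (nbWalk-tail a (b ∷ l ++ x ∷ y ∷ []) p) q)
    where
    nb-head : ∀ l → nb a (l ++ x ∷ y ∷ []) ≡ nb a (l ++ x ∷ y ∷ r)
    nb-head []      = refl
    nb-head (_ ∷ _) = refl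

  walk-adj : ∀ a b r → T (walk (a ∷ b ∷ r)) → T (adj a b)
  walk-adj a b r p = proj₁ (∧-elim (adj a b) p)

  walk-tail : ∀ a r → T (walk (a ∷ r)) → T (walk r)
  walk-tail a []      p = tt
  walk-tail a (b ∷ r) p = proj₂ (∧-elim (adj a b) p)

  walk-∷ : ∀ {a b} r → T (adj a b) → T (walk (b ∷ r)) → T (walk (a ∷ b ∷ r))
  walk-∷ r = ∧-intro

  walk-prefix : ∀ l r → T (walk (l ++ r)) → T (walk l)
  walk-prefix []          r p = tt
  walk-prefix (a ∷ [])    r p = tt
  walk-prefix (a ∷ b ∷ l) r p =
    walk-∷ l (walk-adj a b (l ++ r) p) (walk-prefix (b ∷ l) r (walk-tail a (b ∷ l ++ r) p))

  nbWalk⇒walk : ∀ l → T (nbWalk l) → T (walk l)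
  nbWalk⇒walk []          p = tt
  nbWalk⇒walk (a ∷ [])    p = tt
  nbWalk⇒walk (a ∷ b ∷ r) p =
    walk-∷ r (nbWalk-adj a b r p) (nbWalk⇒walk (b ∷ r) (nbWalk-tail a (b ∷ r) p))

  walk⇒pathTo : ∀ f x l → T (walk (x ∷ l ++ f ∷ [])) → T (pathTo adj f (x ∷ l))
  walk⇒pathTo f x []      p = walk-adj x f [] p
  walk⇒pathTo f x (y ∷ l) p =
    ∧-intro (walk-adj x y (l ++ f ∷ []) p) (walk⇒pathTo f y l (walk-tail x (y ∷ l ++ f ∷ []) p))

  pathTo⇒walk : ∀ f x l → T (pathTo adj f (x ∷ l)) → T (walk (x ∷ l ++ f ∷ []))
  pathTo⇒walk f x []      p = walk-∷ [] p tt
  pathTo⇒walk f x (y ∷ l) p =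
    let x~y , rest = ∧-elim (adj x y) p in walk-∷ (l ++ f ∷ []) x~y (pathTo⇒walk f y l rest)

  not-any⇒not-eq : ∀ x l y r → T (not (any (eq x) (l ++ y ∷ r))) → T (not (eq x y))
  not-any⇒not-eq x []      y r p = not-intro (not-elim p ∘ Equivalence.from T-∨ ∘ inj₁)
  not-any⇒not-eq x (c ∷ l) y r p =
    not-any⇒not-eq x l y r (not-intro (not-elim p ∘ Equivalence.from T-∨ ∘ inj₂))

  distinct-∷⁻ : ∀ x l y r → T (distinct eq (x ∷ l ++ y ∷ r)) → x ≢ y
  distinct-∷⁻ x l y r d =
    not-eq⇒≢ (not-any⇒not-eq x l y r (proj₁ (∧-elim (not (any (eq x) (l ++ y ∷ r))) d)))

  distinct-walk⇒nbWalk : ∀ l → T (walk l) → T (distinct eq l) → T (nbWalk l)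
  distinct-walk⇒nbWalk []              w d = tt
  distinct-walk⇒nbWalk (a ∷ [])        w d = tt
  distinct-walk⇒nbWalk (a ∷ b ∷ [])    w d = nbWalk-∷ [] (walk-adj a b [] w) tt tt
  distinct-walk⇒nbWalk (a ∷ b ∷ c ∷ r) w d =
    let a-fresh , rest-distinct = ∧-elim (not (any (eq a) (b ∷ c ∷ r))) d
    in nbWalk-∷ (c ∷ r) (walk-adj a b (c ∷ r) w) (not-any⇒not-eq a (b ∷ []) c r a-fresh)
                (distinct-walk⇒nbWalk (b ∷ c ∷ r) (walk-tail a (b ∷ c ∷ r) w) rest-distinct)

  closedNB⇒closedWalk : ∀ x xs → T (closedNB (x ∷ xs)) → T (closedWalk adj (x ∷ xs))
  closedNB⇒closedWalk x xs p =
    walk⇒pathTo x x xs (walk-prefix (x ∷ xs ++ x ∷ []) xs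
      (subst (T ∘ walk ∘ (x ∷_)) (sym (++-assoc xs (x ∷ []) xs)) (nbWalk⇒walk (x ∷ xs ++ x ∷ xs) p)))

  side-odd-walk : ∀ j x t y → length t ≡ suc (j + j) → T (walk (x ∷ t ++ y ∷ [])) → side y ≡ side x
  side-odd-walk zero    x (a ∷ [])    y refl w =
    side-2step (walk-adj x a (y ∷ []) w) (walk-adj a y [] (walk-tail x (a ∷ y ∷ []) w))
  side-odd-walk (suc j) x (a ∷ b ∷ t) y len  w =
    trans (side-odd-walk j b t y (trans (suc-injective (suc-injective len)) (+-suc j j)) w-from-b)
          (side-2step (walk-adj x a (b ∷ t ++ y ∷ []) w) (walk-adj a b (t ++ y ∷ []) w-from-a))
    where
    w-from-a : T (walk (a ∷ b ∷ t ++ y ∷ []))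
    w-from-a = walk-tail x (a ∷ b ∷ t ++ y ∷ []) w
    w-from-b : T (walk (b ∷ t ++ y ∷ []))
    w-from-b = walk-tail a (b ∷ t ++ y ∷ []) w-from-a

  nbWalks-from : ∀ x y j → ∑[ t ∈ Seqs j ] 𝟙 (nbWalk (x ∷ y ∷ t)) ≡ 𝟙 (adj x y) * n ^ j
  nbWalks-from x y zero with adj x y
  ... | true  = refl
  ... | false = refl
  nbWalks-from x y (suc j) = begin
    ∑[ t ∈ Seqs (suc j) ] 𝟙 (nbWalk (x ∷ y ∷ t))
      ≡⟨ ∑-Seqs-suc j (λ t → 𝟙 (nbWalk (x ∷ y ∷ t))) ⟩
    ∑[ z ∈ Vs ] ∑[ t ∈ Seqs j ] 𝟙 (nbWalk (x ∷ y ∷ z ∷ t))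
      ≡⟨ ∑-cong Vs first-step ⟩
    ∑[ z ∈ Vs ] 𝟙 (adj x y ∧ (not (eq x z) ∧ adj y z)) * n ^ j
      ≡⟨ ∑-*ʳ Vs (n ^ j) (λ z → 𝟙 (adj x y ∧ (not (eq x z) ∧ adj y z))) ⟩
    count (λ z → adj x y ∧ (not (eq x z) ∧ adj y z)) * n ^ j
      ≡⟨ cong (_* n ^ j) continuations ⟩
    𝟙 (adj x y) * n * n ^ j
      ≡⟨ *-assoc (𝟙 (adj x y)) n (n ^ j) ⟩
    𝟙 (adj x y) * n ^ suc j ∎
    where
    open ≡-Reasoning
    first-step : ∀ z → ∑[ t ∈ Seqs j ] 𝟙 (nbWalk (x ∷ y ∷ z ∷ t)) ≡
                       𝟙 (adj x y ∧ (not (eq x z) ∧ adj y z)) * n ^ j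
    first-step z with adj x y | eq x z
    ... | false | _     = ∑-zero (Seqs j)
    ... | true  | true  = ∑-zero (Seqs j)
    ... | true  | false = nbWalks-from y z j
    continuations : count (λ z → adj x y ∧ (not (eq x z) ∧ adj y z)) ≡ 𝟙 (adj x y) * n
    continuations with adj x y in x~y
    ... | false = ∑-zero Vs
    ... | true  = begin
      count (λ z → not (eq x z) ∧ adj y z)  ≡⟨ ∑-cong Vs (λ z → cong 𝟙 (∧-comm (not (eq x z)) (adj y z))) ⟩
      count (λ z → adj y z ∧ not (eq x z))  ≡⟨ degree-without y x (adj-flip (subst T (sym x~y) tt)) ⟩
      n                                      ≡⟨ +-identityʳ n ⟨
      1 * n                                  ∎

  nbWalksBetween : X → X → ℕ → ℕ
  nbWalksBetween x y d = ∑[ a ∈ Seqs d ] 𝟙 (nbWalk (x ∷ a ++ y ∷ []))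

  nbWalksBetween-≤ : ∀ x y d → nbWalksBetween x y (suc d) ≤ suc n ^ d
  nbWalksBetween-≤ x y zero = begin
    nbWalksBetween x y 1
      ≡⟨ ∑-Seqs-suc 0 (λ a → 𝟙 (nbWalk (x ∷ a ++ y ∷ []))) ⟩
    ∑[ z ∈ Vs ] ∑[ t ∈ Seqs 0 ] 𝟙 (nbWalk (x ∷ z ∷ t ++ y ∷ []))
      ≡⟨ ∑-cong Vs (λ z → ∑-Seqs-zero (λ t → 𝟙 (nbWalk (x ∷ z ∷ t ++ y ∷ [])))) ⟩
    count (λ z → nbWalk (x ∷ z ∷ y ∷ []))
      ≤⟨ count-≤1 _ middle-unique ⟩
    1 ∎
    where
    open ≤-Reasoning
    middle-unique : ∀ z z′ → T (nbWalk (x ∷ z ∷ y ∷ [])) → T (nbWalk (x ∷ z′ ∷ y ∷ [])) → z ≡ z′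
    middle-unique z z′ p q =
      common-unique x y z z′ (not-eq⇒≢ (nbWalk-nb x z (y ∷ []) p))
        (nbWalk-adj x z (y ∷ []) p) (adj-flip (nbWalk-adj z y [] (nbWalk-tail x (z ∷ y ∷ []) p)))
        (nbWalk-adj x z′ (y ∷ []) q) (adj-flip (nbWalk-adj z′ y [] (nbWalk-tail x (z′ ∷ y ∷ []) q)))
  nbWalksBetween-≤ x y (suc d) = begin
    nbWalksBetween x y (suc (suc d))
      ≡⟨ ∑-Seqs-suc (suc d) (λ a → 𝟙 (nbWalk (x ∷ a ++ y ∷ []))) ⟩
    ∑[ z ∈ Vs ] ∑[ a ∈ Seqs (suc d) ] 𝟙 (nbWalk (x ∷ z ∷ a ++ y ∷ []))
      ≤⟨ ∑-mono Vs (λ z → ∑-mono (Seqs (suc d)) (λ a → drop-first z (a ++ y ∷ []))) ⟩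
    ∑[ z ∈ Vs ] ∑[ a ∈ Seqs (suc d) ] 𝟙 (adj x z) * 𝟙 (nbWalk (z ∷ a ++ y ∷ []))
      ≡⟨ ∑-cong Vs (λ z → ∑-*ˡ (Seqs (suc d)) (𝟙 (adj x z)) (λ a → 𝟙 (nbWalk (z ∷ a ++ y ∷ [])))) ⟩
    ∑[ z ∈ Vs ] 𝟙 (adj x z) * nbWalksBetween z y (suc d)
      ≤⟨ ∑-mono Vs (λ z → *-monoʳ-≤ (𝟙 (adj x z)) (nbWalksBetween-≤ z y d)) ⟩
    ∑[ z ∈ Vs ] 𝟙 (adj x z) * suc n ^ d
      ≡⟨ ∑-*ʳ Vs (suc n ^ d) (𝟙 ∘ adj x) ⟩
    count (adj x) * suc n ^ d
      ≡⟨ cong (_* suc n ^ d) (degree x) ⟩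
    suc n ^ suc d ∎
    where
    open ≤-Reasoning
    drop-first : ∀ z r → 𝟙 (nbWalk (x ∷ z ∷ r)) ≤ 𝟙 (adj x z) * 𝟙 (nbWalk (z ∷ r))
    drop-first z r = 𝟙-≤-* (λ p → nbWalk-adj x z r p , nbWalk-tail x (z ∷ r) p)

  nbWalksBetween-self : ∀ y → nbWalksBetween y y 0 ≡ 0
  nbWalksBetween-self y =
    trans (∑-Seqs-zero (λ a → 𝟙 (nbWalk (y ∷ a ++ y ∷ []))))
          (𝟙-false (adj-irrefl y ∘ nbWalk-adj y y []))

  nbLoops-≤ : ∀ y a b → nbWalksBetween y y a * nbWalksBetween y y b ≤ suc n ^ (a + b ∸ 2)
  nbLoops-≤ y zero    b       =
    ≤-trans (≤-reflexive (cong (_* nbWalksBetween y y b) (nbWalksBetween-self y))) z≤n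
  nbLoops-≤ y (suc a) zero    =
    ≤-trans (≤-reflexive (trans (cong (nbWalksBetween y y (suc a) *_) (nbWalksBetween-self y))
                                (*-zeroʳ (nbWalksBetween y y (suc a))))) z≤n
  nbLoops-≤ y (suc a) (suc b) = begin
    nbWalksBetween y y (suc a) * nbWalksBetween y y (suc b)
      ≤⟨ *-mono-≤ (nbWalksBetween-≤ y y a) (nbWalksBetween-≤ y y b) ⟩
    suc n ^ a * suc n ^ b
      ≡⟨ ^-distribˡ-+-* (suc n) a b ⟨
    suc n ^ (a + b)
      ≡⟨ cong (λ m → suc n ^ (m ∸ 1)) (+-suc a b) ⟨
    suc n ^ (suc a + suc b ∸ 2) ∎
    where open ≤-Reasoning

  -- Closing a walk with three vertices

  stepAvoiding : X → X → X → X → Bool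
  stepAvoiding prev x t c = adj x c ∧ (not (eq prev c) ∧ not (adj c t))

  stepAvoiding⁻ : ∀ prev x t c → T (stepAvoiding prev x t c) → T (adj x c) × prev ≢ c × ¬ T (adj c t)
  stepAvoiding⁻ prev x t c s =
    let x~c , rest = ∧-elim (adj x c) s
        prev≠c , c≁t = ∧-elim (not (eq prev c)) rest
    in x~c , not-eq⇒≢ prev≠c , not-elim c≁t

  count-stepAvoiding-≤n : ∀ prev x t → T (adj x prev) → count (stepAvoiding prev x t) ≤ n
  count-stepAvoiding-≤n prev x t x~prev =
    ≤-trans (∑-mono Vs (λ c → 𝟙-mono (neighbour c))) (≤-reflexive (degree-without x prev x~prev))
    where
    neighbour : ∀ c → T (stepAvoiding prev x t c) → T (adj x c ∧ not (eq prev c))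
    neighbour c s = let x~c , prev≢c , _ = stepAvoiding⁻ prev x t c s in ∧-intro x~c (≢⇒not-eq prev≢c)

  count-stepAvoiding-≤n∸1 : ∀ prev x t z → T (adj x prev) → T (adj x z) → T (adj t z) → prev ≢ z →
                            count (stepAvoiding prev x t) ≤ n ∸ 1
  count-stepAvoiding-≤n∸1 prev x t z x~prev x~z t~z prev≢z =
    ≤-trans (∑-mono Vs (λ c → 𝟙-mono (neighbour c))) (≤-reflexive (degree-without₂ x prev z x~prev x~z prev≢z))
    where
    neighbour : ∀ c → T (stepAvoiding prev x t c) → T ((adj x c ∧ not (eq prev c)) ∧ not (eq z c))
    neighbour c s =
      let x~c , prev≢c , c≁t = stepAvoiding⁻ prev x t c s
      in ∧-intro (∧-intro x~c (≢⇒not-eq prev≢c))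
                 (≢⇒not-eq (λ z≡c → c≁t (subst (λ y → T (adj y t)) z≡c (adj-flip t~z))))

  count-stepAvoiding-≤ : ∀ prev x t → T (adj x prev) → side x ≡ side t →
                         count (stepAvoiding prev x t) ≤ n ∸ 1 + 𝟙 (adj prev t)
  count-stepAvoiding-≤ prev x t x~prev sides with T? (eq x t)
  ... | yes x=t = ≤-trans (≤-reflexive (count-zero _ none)) z≤n
    where
    none : ∀ c → ¬ T (stepAvoiding prev x t c)
    none c s = let x~c , _ , c≁t = stepAvoiding⁻ prev x t c s
               in c≁t (adj-flip (subst (λ y → T (adj y c)) (eq-sound x t x=t) x~c))
  ... | no x≠t with common-exists x t (x≠t ∘ ≡⇒eq) sides | T? (adj prev t)
  ...   | _ , _ , _     | yes prev~t =
    ≤-trans (count-stepAvoiding-≤n prev x t x~prev)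
            (≤-trans (m≤n+m∸n n 1) (≤-reflexive (trans (+-comm 1 (n ∸ 1)) (cong (n ∸ 1 +_) (sym (𝟙-true prev~t))))))
  ...   | z , x~z , t~z | no ¬prev~t =
    ≤-trans (count-stepAvoiding-≤n∸1 prev x t z x~prev x~z t~z
               (λ prev≡z → ¬prev~t (subst (λ y → T (adj y t)) (sym prev≡z) (adj-flip t~z))))
            (m≤m+n (n ∸ 1) _)

  -- Among the n + 1 neighbours of x, only prev and the common neighbour of x and t are excluded.
  count-stepAvoiding-≥ : ∀ prev x t → x ≢ t → n ∸ 1 ≤ count (stepAvoiding prev x t)
  count-stepAvoiding-≥ prev x t x≢t =
    ∸-monoˡ-≤ 1 (≤-pred (begin
      suc n
        ≡⟨ degree x ⟨
      count (adj x)
        ≤⟨ ∑-mono Vs (λ c → 𝟙-cover (classify c)) ⟩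
      ∑[ c ∈ Vs ] 𝟙 (stepAvoiding prev x t c) + (𝟙 (eq prev c) + 𝟙 (adj x c ∧ adj t c))
        ≡⟨ trans (∑-+ Vs _ _) (cong (count (stepAvoiding prev x t) +_) (∑-+ Vs _ _)) ⟩
      count (stepAvoiding prev x t) + (count (eq prev) + count (λ c → adj x c ∧ adj t c))
        ≤⟨ +-monoʳ-≤ (count (stepAvoiding prev x t))
                     (+-mono-≤ (≤-reflexive (occurs-once prev)) (count-≤1 _ common)) ⟩
      count (stepAvoiding prev x t) + 2
        ≡⟨ +-comm (count (stepAvoiding prev x t)) 2 ⟩
      suc (suc (count (stepAvoiding prev x t))) ∎))
    where
    open ≤-Reasoning
    classify : ∀ c → T (adj x c) → T (stepAvoiding prev x t c) ⊎ T (eq prev c) ⊎ T (adj x c ∧ adj t c)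
    classify c x~c with T? (eq prev c) | T? (adj c t)
    ... | yes prev=c | _       = inj₂ (inj₁ prev=c)
    ... | no  _      | yes c~t = inj₂ (inj₂ (∧-intro x~c (adj-flip c~t)))
    ... | no  prev≠c | no c≁t  = inj₁ (∧-intro x~c (∧-intro (not-intro prev≠c) (not-intro c≁t)))
    common : ∀ c c′ → T (adj x c ∧ adj t c) → T (adj x c′ ∧ adj t c′) → c ≡ c′
    common c c′ p q = let x~c , t~c = ∧-elim (adj x c) p ; x~c′ , t~c′ = ∧-elim (adj x c′) q
                      in common-unique x t c c′ x≢t x~c t~c x~c′ t~c′

  record Closing (u w c₁ c₂ c₃ w₀ w₁ : X) : Set where
    field
      u≢c₁  : u ≢ c₁
      w~c₁  : T (adj w c₁)
      w≢c₂  : w ≢ c₂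
      c₁~c₂ : T (adj c₁ c₂)
      c₁≢c₃ : c₁ ≢ c₃
      c₂~c₃ : T (adj c₂ c₃)
      c₂≢w₀ : c₂ ≢ w₀
      c₃~w₀ : T (adj c₃ w₀)
      c₃≢w₁ : c₃ ≢ w₁

  closing⁻ : ∀ u w c₁ c₂ c₃ w₀ w₁ → T (nbWalk (u ∷ w ∷ c₁ ∷ c₂ ∷ c₃ ∷ w₀ ∷ w₁ ∷ [])) →
             Closing u w c₁ c₂ c₃ w₀ w₁
  closing⁻ u w c₁ c₂ c₃ w₀ w₁ p₀ = record
    { u≢c₁  = not-eq⇒≢ (nbWalk-nb u w (c₁ ∷ c₂ ∷ c₃ ∷ w₀ ∷ w₁ ∷ []) p₀)
    ; w~c₁  = nbWalk-adj w c₁ (c₂ ∷ c₃ ∷ w₀ ∷ w₁ ∷ []) p₁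
    ; w≢c₂  = not-eq⇒≢ (nbWalk-nb w c₁ (c₂ ∷ c₃ ∷ w₀ ∷ w₁ ∷ []) p₁)
    ; c₁~c₂ = nbWalk-adj c₁ c₂ (c₃ ∷ w₀ ∷ w₁ ∷ []) p₂
    ; c₁≢c₃ = not-eq⇒≢ (nbWalk-nb c₁ c₂ (c₃ ∷ w₀ ∷ w₁ ∷ []) p₂)
    ; c₂~c₃ = nbWalk-adj c₂ c₃ (w₀ ∷ w₁ ∷ []) p₃
    ; c₂≢w₀ = not-eq⇒≢ (nbWalk-nb c₂ c₃ (w₀ ∷ w₁ ∷ []) p₃)
    ; c₃~w₀ = nbWalk-adj c₃ w₀ (w₁ ∷ []) p₄
    ; c₃≢w₁ = not-eq⇒≢ (nbWalk-nb c₃ w₀ (w₁ ∷ []) p₄)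
    }
    where
    p₁ : T (nbWalk (w ∷ c₁ ∷ c₂ ∷ c₃ ∷ w₀ ∷ w₁ ∷ []))
    p₁ = nbWalk-tail u (w ∷ c₁ ∷ c₂ ∷ c₃ ∷ w₀ ∷ w₁ ∷ []) p₀
    p₂ : T (nbWalk (c₁ ∷ c₂ ∷ c₃ ∷ w₀ ∷ w₁ ∷ []))
    p₂ = nbWalk-tail w (c₁ ∷ c₂ ∷ c₃ ∷ w₀ ∷ w₁ ∷ []) p₁
    p₃ : T (nbWalk (c₂ ∷ c₃ ∷ w₀ ∷ w₁ ∷ []))
    p₃ = nbWalk-tail c₁ (c₂ ∷ c₃ ∷ w₀ ∷ w₁ ∷ []) p₂
    p₄ : T (nbWalk (c₃ ∷ w₀ ∷ w₁ ∷ []))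
    p₄ = nbWalk-tail c₂ (c₃ ∷ w₀ ∷ w₁ ∷ []) p₃

  closing⁺ : ∀ {u w c₁ c₂ c₃ w₀ w₁} → T (adj u w) → Closing u w c₁ c₂ c₃ w₀ w₁ → T (adj w₀ w₁) →
             T (nbWalk (u ∷ w ∷ c₁ ∷ c₂ ∷ c₃ ∷ w₀ ∷ w₁ ∷ []))
  closing⁺ {u} {w} {c₁} {c₂} {c₃} {w₀} {w₁} u~w cl w₀~w₁ =
    nbWalk-∷ (c₁ ∷ c₂ ∷ c₃ ∷ w₀ ∷ w₁ ∷ []) u~w (≢⇒not-eq u≢c₁)
    (nbWalk-∷ (c₂ ∷ c₃ ∷ w₀ ∷ w₁ ∷ []) w~c₁ (≢⇒not-eq w≢c₂)
    (nbWalk-∷ (c₃ ∷ w₀ ∷ w₁ ∷ []) c₁~c₂ (≢⇒not-eq c₁≢c₃)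
    (nbWalk-∷ (w₀ ∷ w₁ ∷ []) c₂~c₃ (≢⇒not-eq c₂≢w₀)
    (nbWalk-∷ (w₁ ∷ []) c₃~w₀ (≢⇒not-eq c₃≢w₁)
    (nbWalk-∷ [] w₀~w₁ tt tt)))))
    where open Closing cl

  closings : X → X → X → X → ℕ
  closings u w w₀ w₁ =
    ∑[ c₁ ∈ Vs ] ∑[ c₂ ∈ Vs ] ∑[ c₃ ∈ Vs ] 𝟙 (nbWalk (u ∷ w ∷ c₁ ∷ c₂ ∷ c₃ ∷ w₀ ∷ w₁ ∷ []))

  module _ (u w w₀ w₁ : X) (u~w : T (adj u w)) (w₀~w₁ : T (adj w₀ w₁)) where

    private
      choice₁ : X → Bool
      choice₁ = stepAvoiding u w w₀

      choice₂ : X → X → Bool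
      choice₂ c₁ = stepAvoiding w c₁ w₁

    -- The closing vertex c₃ is the unique common neighbour of c₂ and w₀.
    closings-at-≤ : ∀ c₁ c₂ → ∑[ c₃ ∈ Vs ] 𝟙 (nbWalk (u ∷ w ∷ c₁ ∷ c₂ ∷ c₃ ∷ w₀ ∷ w₁ ∷ [])) ≤
                              𝟙 (choice₁ c₁) * 𝟙 (choice₂ c₁ c₂)
    closings-at-≤ c₁ c₂ =
      subst (count (λ c₃ → nbWalk (u ∷ w ∷ c₁ ∷ c₂ ∷ c₃ ∷ w₀ ∷ w₁ ∷ [])) ≤_) (𝟙-∧ (choice₁ c₁) (choice₂ c₁ c₂))
            (count-≤-𝟙 _ (choice₁ c₁ ∧ choice₂ c₁ c₂) avoiding unique)
      where
      avoiding : ∀ c₃ → T (nbWalk (u ∷ w ∷ c₁ ∷ c₂ ∷ c₃ ∷ w₀ ∷ w₁ ∷ [])) → T (choice₁ c₁ ∧ choice₂ c₁ c₂)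
      avoiding c₃ p = ∧-intro (∧-intro w~c₁ (∧-intro (≢⇒not-eq u≢c₁) (not-intro c₁≁w₀)))
                              (∧-intro c₁~c₂ (∧-intro (≢⇒not-eq w≢c₂) (not-intro c₂≁w₁)))
        where
        open Closing (closing⁻ u w c₁ c₂ c₃ w₀ w₁ p)
        c₁≁w₀ : ¬ T (adj c₁ w₀)
        c₁≁w₀ c₁~w₀ =
          c₁≢c₃ (common-unique c₂ w₀ c₁ c₃ c₂≢w₀ (adj-flip c₁~c₂) (adj-flip c₁~w₀) c₂~c₃ (adj-flip c₃~w₀))
        c₂≁w₁ : ¬ T (adj c₂ w₁)
        c₂≁w₁ c₂~w₁ = c₃≢w₁ (sym (common-unique c₂ w₀ w₁ c₃ c₂≢w₀ c₂~w₁ w₀~w₁ c₂~c₃ (adj-flip c₃~w₀)))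
      unique : ∀ c₃ c₃′ → T (nbWalk (u ∷ w ∷ c₁ ∷ c₂ ∷ c₃ ∷ w₀ ∷ w₁ ∷ [])) →
               T (nbWalk (u ∷ w ∷ c₁ ∷ c₂ ∷ c₃′ ∷ w₀ ∷ w₁ ∷ [])) → c₃ ≡ c₃′
      unique c₃ c₃′ p q =
        common-unique c₂ w₀ c₃ c₃′ c₂≢w₀ c₂~c₃ (adj-flip c₃~w₀) (Closing.c₂~c₃ cl′) (adj-flip (Closing.c₃~w₀ cl′))
        where
        open Closing (closing⁻ u w c₁ c₂ c₃ w₀ w₁ p)
        cl′ : Closing u w c₁ c₂ c₃′ w₀ w₁
        cl′ = closing⁻ u w c₁ c₂ c₃′ w₀ w₁ q

    closings-at-≥ : side w ≡ side w₀ → ∀ c₁ c₂ → T (choice₁ c₁) → T (choice₂ c₁ c₂) →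
                    1 ≤ ∑[ c₃ ∈ Vs ] 𝟙 (nbWalk (u ∷ w ∷ c₁ ∷ c₂ ∷ c₃ ∷ w₀ ∷ w₁ ∷ []))
    closings-at-≥ sides c₁ c₂ a₁ a₂ =
      let w~c₁ , u≢c₁ , c₁≁w₀ = stepAvoiding⁻ u w w₀ c₁ a₁
          c₁~c₂ , w≢c₂ , c₂≁w₁ = stepAvoiding⁻ w c₁ w₁ c₂ a₂
          c₂≢w₀ : c₂ ≢ w₀
          c₂≢w₀ c₂≡w₀ = c₁≁w₀ (subst (T ∘ adj c₁) c₂≡w₀ c₁~c₂)
          c₃ , c₂~c₃ , w₀~c₃ = common-exists c₂ w₀ c₂≢w₀ (trans (side-2step w~c₁ c₁~c₂) sides)
      in count-pos _ c₃ (closing⁺ u~w (record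
           { u≢c₁ = u≢c₁ ; w~c₁ = w~c₁ ; w≢c₂ = w≢c₂ ; c₁~c₂ = c₁~c₂
           ; c₁≢c₃ = λ c₁≡c₃ → c₁≁w₀ (subst (λ y → T (adj y w₀)) (sym c₁≡c₃) (adj-flip w₀~c₃))
           ; c₂~c₃ = c₂~c₃ ; c₂≢w₀ = c₂≢w₀ ; c₃~w₀ = adj-flip w₀~c₃
           ; c₃≢w₁ = λ c₃≡w₁ → c₂≁w₁ (subst (T ∘ adj c₂) c₃≡w₁ c₂~c₃)
           }) w₀~w₁)

    closings-≤ : closings u w w₀ w₁ ≤ (n ∸ 1) * (n ∸ 1) + suc n * (𝟙 (adj u w₀) + 𝟙 (adj w w₁))
    closings-≤ with side w ≟ᵇ side w₀
    ... | no sides≢ = ≤-trans (≤-reflexive closings≡0) z≤n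
      where
      closings≡0 : closings u w w₀ w₁ ≡ 0
      closings≡0 =
        trans (∑-cong Vs (λ c₁ → trans (∑-cong Vs (λ c₂ → count-zero _ (λ c₃ p → sides≢ (sides-of c₁ c₂ c₃ p))))
                                       (∑-zero Vs)))
              (∑-zero Vs)
        where
        sides-of : ∀ c₁ c₂ c₃ → T (nbWalk (u ∷ w ∷ c₁ ∷ c₂ ∷ c₃ ∷ w₀ ∷ w₁ ∷ [])) → side w ≡ side w₀
        sides-of c₁ c₂ c₃ p = sym (trans (side-2step c₂~c₃ c₃~w₀) (side-2step w~c₁ c₁~c₂))
          where open Closing (closing⁻ u w c₁ c₂ c₃ w₀ w₁ p)
    ... | yes sides = begin
      closings u w w₀ w₁
        ≤⟨ ∑-mono Vs (λ c₁ → ∑-mono Vs (closings-at-≤ c₁)) ⟩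
      ∑[ c₁ ∈ Vs ] ∑[ c₂ ∈ Vs ] 𝟙 (choice₁ c₁) * 𝟙 (choice₂ c₁ c₂)
        ≡⟨ ∑-cong Vs (λ c₁ → ∑-*ˡ Vs (𝟙 (choice₁ c₁)) (𝟙 ∘ choice₂ c₁)) ⟩
      ∑[ c₁ ∈ Vs ] 𝟙 (choice₁ c₁) * count (choice₂ c₁)
        ≤⟨ ∑-mono Vs (λ c₁ → 𝟙*-mono (choice₁ c₁) (second-≤ c₁)) ⟩
      ∑[ c₁ ∈ Vs ] 𝟙 (choice₁ c₁) * (n ∸ 1 + 𝟙 (adj w w₁))
        ≡⟨ ∑-*ʳ Vs (n ∸ 1 + 𝟙 (adj w w₁)) (𝟙 ∘ choice₁) ⟩
      count choice₁ * (n ∸ 1 + 𝟙 (adj w w₁))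
        ≤⟨ *-monoˡ-≤ (n ∸ 1 + 𝟙 (adj w w₁)) (count-stepAvoiding-≤ u w w₀ (adj-flip u~w) sides) ⟩
      (n ∸ 1 + 𝟙 (adj u w₀)) * (n ∸ 1 + 𝟙 (adj w w₁))
        ≤⟨ +-*-+-≤ (m∸n≤m n 1) (𝟙≤1 (adj w w₁)) ⟩
      (n ∸ 1) * (n ∸ 1) + suc n * (𝟙 (adj u w₀) + 𝟙 (adj w w₁)) ∎
      where
      open ≤-Reasoning
      second-≤ : ∀ c₁ → T (choice₁ c₁) → count (choice₂ c₁) ≤ n ∸ 1 + 𝟙 (adj w w₁)
      second-≤ c₁ a₁ =
        let w~c₁ , _ = stepAvoiding⁻ u w w₀ c₁ a₁
        in count-stepAvoiding-≤ w c₁ w₁ (adj-flip w~c₁)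
             (trans (adj-side w c₁ w~c₁) (trans (cong not sides) (sym (adj-side w₀ w₁ w₀~w₁))))

    closings-≥ : w ≢ w₀ → side w ≡ side w₀ → (n ∸ 1) * (n ∸ 1) ≤ closings u w w₀ w₁
    closings-≥ w≢w₀ sides = begin
      (n ∸ 1) * (n ∸ 1)
        ≤⟨ *-monoˡ-≤ (n ∸ 1) (count-stepAvoiding-≥ u w w₀ w≢w₀) ⟩
      count choice₁ * (n ∸ 1)
        ≡⟨ ∑-*ʳ Vs (n ∸ 1) (𝟙 ∘ choice₁) ⟨
      ∑[ c₁ ∈ Vs ] 𝟙 (choice₁ c₁) * (n ∸ 1)
        ≤⟨ ∑-mono Vs (λ c₁ → 𝟙*-mono (choice₁ c₁) (second-≥ c₁)) ⟩
      ∑[ c₁ ∈ Vs ] 𝟙 (choice₁ c₁) * count (choice₂ c₁)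
        ≡⟨ ∑-cong Vs (λ c₁ → ∑-*ˡ Vs (𝟙 (choice₁ c₁)) (𝟙 ∘ choice₂ c₁)) ⟨
      ∑[ c₁ ∈ Vs ] ∑[ c₂ ∈ Vs ] 𝟙 (choice₁ c₁) * 𝟙 (choice₂ c₁ c₂)
        ≤⟨ ∑-mono Vs (λ c₁ → ∑-mono Vs (λ c₂ →
             𝟙*𝟙-≤ (choice₁ c₁) (choice₂ c₁ c₂) (closings-at-≥ sides c₁ c₂))) ⟩
      closings u w w₀ w₁ ∎
      where
      open ≤-Reasoning
      second-≥ : ∀ c₁ → T (choice₁ c₁) → n ∸ 1 ≤ count (choice₂ c₁)
      second-≥ c₁ a₁ =
        let _ , _ , c₁≁w₀ = stepAvoiding⁻ u w w₀ c₁ a₁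
        in count-stepAvoiding-≥ w c₁ w₁ (λ c₁≡w₁ → c₁≁w₀ (subst (λ y → T (adj y w₀)) (sym c₁≡w₁) (adj-flip w₀~w₁)))

  -- Closed walks with a repeated vertex

  firstOccurrence-≤ : ∀ y (R : List X → Bool) j →
    ∑[ t ∈ Seqs j ] 𝟙 (R t ∧ any (eq y) t) ≤
    ∑[ d < j ] ∑[ a ∈ Seqs d ] ∑[ b ∈ Seqs (j ∸ suc d) ] 𝟙 (R (a ++ y ∷ b))
  firstOccurrence-≤ y R zero    = ≤-reflexive (cong (λ b → 𝟙 b + 0) (∧-zeroʳ (R [])))
  firstOccurrence-≤ y R (suc j) = begin
    ∑[ t ∈ Seqs (suc j) ] 𝟙 (R t ∧ any (eq y) t)
      ≡⟨ ∑-Seqs-suc j (λ t → 𝟙 (R t ∧ any (eq y) t)) ⟩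
    ∑[ x ∈ Vs ] ∑[ t ∈ Seqs j ] 𝟙 (R (x ∷ t) ∧ (eq y x ∨ any (eq y) t))
      ≤⟨ ∑-mono Vs (λ x → ∑-mono (Seqs j) (λ t → 𝟙-∧-∨-≤ (R (x ∷ t)) (eq y x) (any (eq y) t))) ⟩
    ∑[ x ∈ Vs ] ∑[ t ∈ Seqs j ] 𝟙 (eq y x) * 𝟙 (R (x ∷ t)) + 𝟙 (R (x ∷ t) ∧ any (eq y) t)
      ≡⟨ ∑-cong Vs (λ x → trans (∑-+ (Seqs j) _ _)
                                (cong (_+ Later x) (∑-*ˡ (Seqs j) (𝟙 (eq y x)) (λ t → 𝟙 (R (x ∷ t)))))) ⟩
    ∑[ x ∈ Vs ] 𝟙 (eq y x) * Here x + Later x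
      ≡⟨ ∑-+ Vs (λ x → 𝟙 (eq y x) * Here x) Later ⟩
    (∑[ x ∈ Vs ] 𝟙 (eq y x) * Here x) + (∑[ x ∈ Vs ] Later x)
      ≤⟨ +-mono-≤ (≤-reflexive (∑-select y Here)) (∑-mono Vs (λ x → firstOccurrence-≤ y (R ∘ (x ∷_)) j)) ⟩
    Here y + (∑[ x ∈ Vs ] ∑[ d < j ] ∑[ a ∈ Seqs d ] ∑[ b ∈ Seqs (j ∸ suc d) ] 𝟙 (R (x ∷ a ++ y ∷ b)))
      ≡⟨ cong₂ _+_ (sym (∑-Seqs-zero (λ a → ∑[ b ∈ Seqs j ] 𝟙 (R (a ++ y ∷ b)))))
                   (trans (∑-∑< Vs j _) (∑<-cong j (λ d → sym (∑-Seqs-suc d _)))) ⟩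
    ∑[ d < suc j ] ∑[ a ∈ Seqs d ] ∑[ b ∈ Seqs (suc j ∸ suc d) ] 𝟙 (R (a ++ y ∷ b)) ∎
    where
    open ≤-Reasoning
    Here : X → ℕ
    Here x = ∑[ t ∈ Seqs j ] 𝟙 (R (x ∷ t))
    Later : X → ℕ
    Later x = ∑[ t ∈ Seqs j ] 𝟙 (R (x ∷ t) ∧ any (eq y) t)

  repeatTerms : (List X → Bool) → ℕ → ℕ → ℕ → ℕ
  repeatTerms R i d e =
    ∑[ pre ∈ Seqs i ] ∑[ y ∈ Vs ] ∑[ a ∈ Seqs d ] ∑[ b ∈ Seqs e ] 𝟙 (R (pre ++ y ∷ a ++ y ∷ b))

  -- Split at the first position i whose vertex y occurs again, d positions later.
  repeats-≤ : ∀ (R : List X → Bool) j →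
    ∑[ t ∈ Seqs j ] 𝟙 (R t ∧ not (distinct eq t)) ≤
    ∑[ i < j ] ∑[ d < j ∸ suc i ] repeatTerms R i d (j ∸ suc i ∸ suc d)
  repeats-≤ R zero    = ≤-reflexive (cong (λ b → 𝟙 b + 0) (∧-zeroʳ (R [])))
  repeats-≤ R (suc j) = begin
    ∑[ t ∈ Seqs (suc j) ] 𝟙 (R t ∧ not (distinct eq t))
      ≡⟨ ∑-Seqs-suc j (λ t → 𝟙 (R t ∧ not (distinct eq t))) ⟩
    ∑[ y ∈ Vs ] ∑[ t ∈ Seqs j ] 𝟙 (R (y ∷ t) ∧ not (not (any (eq y) t) ∧ distinct eq t))
      ≤⟨ ∑-mono Vs (λ y → ∑-mono (Seqs j) (λ t →
           𝟙-∧-not-∧-≤ (R (y ∷ t)) (any (eq y) t) (distinct eq t))) ⟩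
    ∑[ y ∈ Vs ] ∑[ t ∈ Seqs j ] 𝟙 (R (y ∷ t) ∧ any (eq y) t) + 𝟙 (R (y ∷ t) ∧ not (distinct eq t))
      ≡⟨ trans (∑-cong Vs (λ y → ∑-+ (Seqs j) _ _)) (∑-+ Vs _ _) ⟩
    (∑[ y ∈ Vs ] ∑[ t ∈ Seqs j ] 𝟙 (R (y ∷ t) ∧ any (eq y) t)) +
    (∑[ y ∈ Vs ] ∑[ t ∈ Seqs j ] 𝟙 (R (y ∷ t) ∧ not (distinct eq t)))
      ≤⟨ +-mono-≤ (∑-mono Vs (λ y → firstOccurrence-≤ y (R ∘ (y ∷_)) j))
                  (∑-mono Vs (λ y → repeats-≤ (R ∘ (y ∷_)) j)) ⟩
    (∑[ y ∈ Vs ] ∑[ d < j ] ∑[ a ∈ Seqs d ] ∑[ b ∈ Seqs (j ∸ suc d) ] 𝟙 (R (y ∷ a ++ y ∷ b))) +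
    (∑[ y ∈ Vs ] ∑[ i < j ] ∑[ d < j ∸ suc i ] repeatTerms (R ∘ (y ∷_)) i d (j ∸ suc i ∸ suc d))
      ≡⟨ cong₂ _+_ (trans (∑-∑< Vs j _) (∑<-cong j (λ d → sym (∑-Seqs-zero (λ pre →
                      ∑[ y ∈ Vs ] ∑[ a ∈ Seqs d ] ∑[ b ∈ Seqs (j ∸ suc d) ] 𝟙 (R (pre ++ y ∷ a ++ y ∷ b)))))))
                   (trans (∑-∑< Vs j _) (∑<-cong j (λ i →
                      trans (∑-∑< Vs (j ∸ suc i) _) (∑<-cong (j ∸ suc i) (λ d → sym (∑-Seqs-suc i _)))))) ⟩
    ∑[ i < suc j ] ∑[ d < suc j ∸ suc i ] repeatTerms R i d (suc j ∸ suc i ∸ suc d) ∎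
    where open ≤-Reasoning

  closedNB-split : ∀ pre y a b → T (closedNB (pre ++ y ∷ a ++ y ∷ b)) →
                   T (nbWalk (y ∷ a ++ y ∷ [])) × T (nbWalk (y ∷ b ++ pre ++ y ∷ []))
  closedNB-split pre y a b p =
    nbWalk-infix pre (y ∷ a ++ y ∷ []) (b ++ s) (subst (T ∘ nbWalk) first p) ,
    nbWalk-infix (pre ++ y ∷ a) (y ∷ b ++ pre ++ y ∷ []) (a ++ y ∷ b) (subst (T ∘ nbWalk) second p)
    where
    s : List X
    s = pre ++ y ∷ a ++ y ∷ b
    s++s : s ++ s ≡ pre ++ y ∷ (a ++ y ∷ (b ++ s))
    s++s = trans (++-assoc pre (y ∷ a ++ y ∷ b) s) (cong (λ t → pre ++ y ∷ t) (++-assoc a (y ∷ b) s))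
    first : s ++ s ≡ pre ++ (y ∷ a ++ y ∷ []) ++ (b ++ s)
    first = trans s++s (cong (λ t → pre ++ y ∷ t) (sym (++-assoc a (y ∷ []) (b ++ s))))
    second : s ++ s ≡ (pre ++ y ∷ a) ++ (y ∷ b ++ pre ++ y ∷ []) ++ (a ++ y ∷ b)
    second = trans s++s (sym (trans (++-assoc pre (y ∷ a) _) (cong (λ t → pre ++ y ∷ (a ++ y ∷ t))
               (trans (++-assoc b (pre ++ y ∷ []) (a ++ y ∷ b)) (cong (b ++_) (++-assoc pre (y ∷ []) (a ++ y ∷ b)))))))

  repeatTerms-closedNB-≤ : ∀ i d e → repeatTerms closedNB i d e ≤ v * suc n ^ (d + (e + i) ∸ 2)
  repeatTerms-closedNB-≤ i d e = begin
    repeatTerms closedNB i d e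
      ≤⟨ ∑-mono (Seqs i) (λ pre → ∑-mono Vs (λ y → ∑-mono (Seqs d) (λ a → ∑-mono (Seqs e) (λ b →
           𝟙-≤-* (closedNB-split pre y a b))))) ⟩
    ∑[ pre ∈ Seqs i ] ∑[ y ∈ Vs ] ∑[ a ∈ Seqs d ] ∑[ b ∈ Seqs e ] loop y a * loop′ y b pre
      ≡⟨ ∑-cong (Seqs i) (λ pre → ∑-cong Vs (λ y → trans (∑-cong (Seqs d) (λ a → ∑-*ˡ (Seqs e) (loop y a) _))
                                                          (∑-*ʳ (Seqs d) _ (loop y)))) ⟩
    ∑[ pre ∈ Seqs i ] ∑[ y ∈ Vs ] nbWalksBetween y y d * (∑[ b ∈ Seqs e ] loop′ y b pre)
      ≡⟨ ∑-comm (Seqs i) Vs _ ⟩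
    ∑[ y ∈ Vs ] ∑[ pre ∈ Seqs i ] nbWalksBetween y y d * (∑[ b ∈ Seqs e ] loop′ y b pre)
      ≡⟨ ∑-cong Vs (λ y → trans (∑-*ˡ (Seqs i) (nbWalksBetween y y d) _)
                                (cong (nbWalksBetween y y d *_)
                                      (trans (∑-comm (Seqs i) (Seqs e) _) (sym (joined y))))) ⟩
    ∑[ y ∈ Vs ] nbWalksBetween y y d * nbWalksBetween y y (e + i)
      ≤⟨ ∑-mono Vs (λ y → nbLoops-≤ y d (e + i)) ⟩
    ∑[ y ∈ Vs ] suc n ^ (d + (e + i) ∸ 2)
      ≡⟨ ∑-const Vs _ ⟩
    v * suc n ^ (d + (e + i) ∸ 2) ∎
    where
    open ≤-Reasoning
    loop : X → List X → ℕ
    loop y a = 𝟙 (nbWalk (y ∷ a ++ y ∷ []))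
    loop′ : X → List X → List X → ℕ
    loop′ y b pre = 𝟙 (nbWalk (y ∷ b ++ pre ++ y ∷ []))
    joined : ∀ y → nbWalksBetween y y (e + i) ≡ ∑[ b ∈ Seqs e ] ∑[ pre ∈ Seqs i ] loop′ y b pre
    joined y = trans (∑-Seqs-+ e i (λ t → 𝟙 (nbWalk (y ∷ t ++ y ∷ []))))
                     (∑-cong (Seqs e) (λ b → ∑-cong (Seqs i) (λ pre →
                        cong (λ t → 𝟙 (nbWalk (y ∷ t))) (++-assoc b pre (y ∷ [])))))

  repeatedClosedNB-≤ : ∀ j → ∑[ t ∈ Seqs j ] 𝟙 (closedNB t ∧ not (distinct eq t)) ≤
                             j * (j * (v * suc n ^ (j ∸ 4)))
  repeatedClosedNB-≤ j = ≤-trans (repeats-≤ closedNB j) (∑<-≤ j (λ i i<j →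
    ≤-trans (∑<-≤ (j ∸ suc i) (λ d d<j-i →
               ≤-trans (repeatTerms-closedNB-≤ i d _)
                       (≤-reflexive (cong (λ m → v * suc n ^ m) (repeat-exponent i<j d<j-i)))))
            (*-monoˡ-≤ _ (m∸n≤m j (suc i)))))

  -- Splitting sequences of length 7 + r as w₀ w₁ mid u w c₁ c₂ c₃

  ∑-Seqs-2 : ∀ (g : List X → ℕ) → ∑ (Seqs 2) g ≡ ∑[ u ∈ Vs ] ∑[ w ∈ Vs ] g (u ∷ w ∷ [])
  ∑-Seqs-2 g = trans (∑-Seqs-suc 1 g) (∑-cong Vs (λ u →
               trans (∑-Seqs-suc 0 (g ∘ (u ∷_))) (∑-cong Vs (λ w → ∑-Seqs-zero (g ∘ (u ∷_) ∘ (w ∷_))))))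

  ∑-Seqs-5 : ∀ (g : List X → ℕ) → ∑ (Seqs 5) g ≡
             ∑[ u ∈ Vs ] ∑[ w ∈ Vs ] ∑[ c₁ ∈ Vs ] ∑[ c₂ ∈ Vs ] ∑[ c₃ ∈ Vs ] g (u ∷ w ∷ c₁ ∷ c₂ ∷ c₃ ∷ [])
  ∑-Seqs-5 g = trans (∑-Seqs-suc 4 g) (∑-cong Vs (λ u →
               trans (∑-Seqs-suc 3 _) (∑-cong Vs (λ w →
               trans (∑-Seqs-suc 2 _) (∑-cong Vs (λ c₁ →
               ∑-Seqs-2 (g ∘ (u ∷_) ∘ (w ∷_) ∘ (c₁ ∷_))))))))

  prefix : X → X → List X → X → X → List X
  prefix w₀ w₁ mid u w = w₀ ∷ w₁ ∷ mid ++ u ∷ w ∷ []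

  nbPrefix : X → X → List X → X → X → Bool
  nbPrefix w₀ w₁ mid u w = nbWalk (prefix w₀ w₁ mid u w)

  ∑prefix : ℕ → (X → X → List X → X → X → ℕ) → ℕ
  ∑prefix r h = ∑[ w₀ ∈ Vs ] ∑[ w₁ ∈ Vs ] ∑[ mid ∈ Seqs r ] ∑[ u ∈ Vs ] ∑[ w ∈ Vs ] h w₀ w₁ mid u w

  module _ (r : ℕ) where

    ∑prefix-mono-length : ∀ {h h′ : X → X → List X → X → X → ℕ} →
      (∀ w₀ w₁ mid u w → length mid ≡ r → h w₀ w₁ mid u w ≤ h′ w₀ w₁ mid u w) → ∑prefix r h ≤ ∑prefix r h′
    ∑prefix-mono-length h≤h′ = ∑-mono Vs (λ w₀ → ∑-mono Vs (λ w₁ → ∑-Seqs-mono r (λ mid |mid| →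
                                 ∑-mono Vs (λ u → ∑-mono Vs (λ w → h≤h′ w₀ w₁ mid u w |mid|)))))

    ∑prefix-mono : ∀ {h h′ : X → X → List X → X → X → ℕ} →
      (∀ w₀ w₁ mid u w → h w₀ w₁ mid u w ≤ h′ w₀ w₁ mid u w) → ∑prefix r h ≤ ∑prefix r h′
    ∑prefix-mono h≤h′ = ∑prefix-mono-length (λ w₀ w₁ mid u w _ → h≤h′ w₀ w₁ mid u w)

    ∑prefix-cong : ∀ {h h′ : X → X → List X → X → X → ℕ} →
      (∀ w₀ w₁ mid u w → h w₀ w₁ mid u w ≡ h′ w₀ w₁ mid u w) → ∑prefix r h ≡ ∑prefix r h′
    ∑prefix-cong h≡h′ = ∑-cong Vs (λ w₀ → ∑-cong Vs (λ w₁ → ∑-cong (Seqs r) (λ mid →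
                          ∑-cong Vs (λ u → ∑-cong Vs (λ w → h≡h′ w₀ w₁ mid u w)))))

    ∑prefix-+ : ∀ (h h′ : X → X → List X → X → X → ℕ) →
      ∑prefix r (λ w₀ w₁ mid u w → h w₀ w₁ mid u w + h′ w₀ w₁ mid u w) ≡ ∑prefix r h + ∑prefix r h′
    ∑prefix-+ h h′ =
      trans (∑-cong Vs (λ w₀ → trans (∑-cong Vs (λ w₁ → trans (∑-cong (Seqs r) (λ mid →
               trans (∑-cong Vs (λ u → ∑-+ Vs _ _)) (∑-+ Vs _ _))) (∑-+ (Seqs r) _ _))) (∑-+ Vs _ _)))
            (∑-+ Vs _ _)

    ∑prefix-*ˡ : ∀ c (h : X → X → List X → X → X → ℕ) →
      ∑prefix r (λ w₀ w₁ mid u w → c * h w₀ w₁ mid u w) ≡ c * ∑prefix r h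
    ∑prefix-*ˡ c h =
      trans (∑-cong Vs (λ w₀ → trans (∑-cong Vs (λ w₁ → trans (∑-cong (Seqs r) (λ mid →
               trans (∑-cong Vs (λ u → ∑-*ˡ Vs c _)) (∑-*ˡ Vs c _))) (∑-*ˡ (Seqs r) c _))) (∑-*ˡ Vs c _)))
            (∑-*ˡ Vs c _)

  ∑-Seqs-7+ : ∀ r (f : List X → ℕ) → ∑ (Seqs (7 + r)) f ≡
    ∑prefix r (λ w₀ w₁ mid u w → ∑[ c₁ ∈ Vs ] ∑[ c₂ ∈ Vs ] ∑[ c₃ ∈ Vs ] f (w₀ ∷ w₁ ∷ mid ++ u ∷ w ∷ c₁ ∷ c₂ ∷ c₃ ∷ []))
  ∑-Seqs-7+ r f = begin
    ∑ (Seqs (7 + r)) f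
      ≡⟨ cong (λ m → ∑ (Seqs (2 + m)) f) (+-comm 5 r) ⟩
    ∑ (Seqs (2 + (r + 5))) f
      ≡⟨ ∑-Seqs-suc (1 + (r + 5)) f ⟩
    ∑[ w₀ ∈ Vs ] ∑[ t ∈ Seqs (1 + (r + 5)) ] f (w₀ ∷ t)
      ≡⟨ ∑-cong Vs (λ w₀ → trans (∑-Seqs-suc (r + 5) _) (∑-cong Vs (λ w₁ →
           trans (∑-Seqs-+ r 5 _) (∑-cong (Seqs r) (λ mid → ∑-Seqs-5 _))))) ⟩
    ∑prefix r (λ w₀ w₁ mid u w → ∑[ c₁ ∈ Vs ] ∑[ c₂ ∈ Vs ] ∑[ c₃ ∈ Vs ] f (w₀ ∷ w₁ ∷ mid ++ u ∷ w ∷ c₁ ∷ c₂ ∷ c₃ ∷ [])) ∎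
    where open ≡-Reasoning

  prefix-edges : ∀ w₀ w₁ mid u w → T (nbPrefix w₀ w₁ mid u w) → T (adj u w) × T (adj w₀ w₁)
  prefix-edges w₀ w₁ mid u w p =
    nbWalk-adj u w [] (nbWalk-suffix (w₀ ∷ w₁ ∷ mid) (u ∷ w ∷ []) p) , nbWalk-adj w₀ w₁ (mid ++ u ∷ w ∷ []) p

  prefix-sides : ∀ j w₀ w₁ mid u w → length mid ≡ suc (j + j) → T (nbPrefix w₀ w₁ mid u w) →
                 side w ≡ side w₀
  prefix-sides j w₀ w₁ mid u w |mid| p =
    side-odd-walk (suc j) w₀ (w₁ ∷ mid ++ u ∷ []) w |t|
      (subst (T ∘ walk ∘ (λ t → w₀ ∷ w₁ ∷ t)) (sym (++-assoc mid (u ∷ []) (w ∷ [])))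
             (nbWalk⇒walk (prefix w₀ w₁ mid u w) p))
    where
    |t| : length (w₁ ∷ mid ++ u ∷ []) ≡ suc (suc j + suc j)
    |t| = trans (cong suc (trans (length-++ mid) (cong (_+ 1) |mid|))) (rearrange j)
      where
      rearrange : ∀ j → suc (suc (j + j) + 1) ≡ suc (suc j + suc j)
      rearrange = solve-∀

  nbPrefixes : ∀ r → ∑prefix r (λ w₀ w₁ mid u w → 𝟙 (nbPrefix w₀ w₁ mid u w)) ≡ v * (suc n * n ^ (r + 2))
  nbPrefixes r = begin
    ∑prefix r (λ w₀ w₁ mid u w → 𝟙 (nbPrefix w₀ w₁ mid u w))
      ≡⟨ ∑-cong Vs (λ w₀ → ∑-cong Vs (λ w₁ → trans
           (∑-cong (Seqs r) (λ mid → sym (∑-Seqs-2 (λ t → 𝟙 (nbWalk (w₀ ∷ w₁ ∷ mid ++ t))))))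
           (sym (∑-Seqs-+ r 2 (λ t → 𝟙 (nbWalk (w₀ ∷ w₁ ∷ t))))))) ⟩
    ∑[ w₀ ∈ Vs ] ∑[ w₁ ∈ Vs ] ∑[ t ∈ Seqs (r + 2) ] 𝟙 (nbWalk (w₀ ∷ w₁ ∷ t))
      ≡⟨ ∑-cong Vs (λ w₀ → ∑-cong Vs (λ w₁ → nbWalks-from w₀ w₁ (r + 2))) ⟩
    ∑[ w₀ ∈ Vs ] ∑[ w₁ ∈ Vs ] 𝟙 (adj w₀ w₁) * n ^ (r + 2)
      ≡⟨ ∑-cong Vs (λ w₀ → trans (∑-*ʳ Vs (n ^ (r + 2)) (𝟙 ∘ adj w₀)) (cong (_* n ^ (r + 2)) (degree w₀))) ⟩
    ∑[ w₀ ∈ Vs ] suc n * n ^ (r + 2)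
      ≡⟨ ∑-const Vs _ ⟩
    v * (suc n * n ^ (r + 2)) ∎
    where open ≡-Reasoning

  nbPrefixes-u~w₀ : ∀ r → ∑prefix r (λ w₀ w₁ mid u w → 𝟙 (nbPrefix w₀ w₁ mid u w) * 𝟙 (adj u w₀)) ≤
                          v * suc n ^ (2 + r)
  nbPrefixes-u~w₀ r = begin
    ∑prefix r (λ w₀ w₁ mid u w → 𝟙 (nbPrefix w₀ w₁ mid u w) * 𝟙 (adj u w₀))
      ≤⟨ ∑prefix-mono r drop-last ⟩
    ∑prefix r (λ w₀ w₁ mid u w → 𝟙 (adj u w) * Ends w₀ w₁ mid u)
      ≡⟨ ∑-cong Vs (λ w₀ → ∑-cong Vs (λ w₁ → ∑-cong (Seqs r) (λ mid → ∑-cong Vs (λ u →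
           trans (∑-*ʳ Vs _ (𝟙 ∘ adj u)) (cong (_* Ends w₀ w₁ mid u) (degree u)))))) ⟩
    ∑[ w₀ ∈ Vs ] ∑[ w₁ ∈ Vs ] ∑[ mid ∈ Seqs r ] ∑[ u ∈ Vs ] suc n * Ends w₀ w₁ mid u
      ≡⟨ ∑-cong Vs (λ w₀ → trans (∑-cong Vs (λ w₁ → ∑-comm (Seqs r) Vs _)) (∑-comm Vs Vs _)) ⟩
    ∑[ w₀ ∈ Vs ] ∑[ u ∈ Vs ] ∑[ w₁ ∈ Vs ] ∑[ mid ∈ Seqs r ] suc n * Ends w₀ w₁ mid u
      ≡⟨ ∑-cong Vs (λ w₀ → ∑-cong Vs (λ u → trans (∑-cong Vs (λ w₁ → ∑-*ˡ (Seqs r) (suc n) _)) (∑-*ˡ Vs (suc n) _))) ⟩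
    ∑[ w₀ ∈ Vs ] ∑[ u ∈ Vs ] suc n * (∑[ w₁ ∈ Vs ] ∑[ mid ∈ Seqs r ] Ends w₀ w₁ mid u)
      ≡⟨ ∑-cong Vs (λ w₀ → ∑-cong Vs (λ u → cong (suc n *_) (trans
           (∑-cong Vs (λ w₁ → ∑-*ˡ (Seqs r) (𝟙 (adj u w₀)) _)) (trans (∑-*ˡ Vs (𝟙 (adj u w₀)) _)
           (cong (𝟙 (adj u w₀) *_) (sym (∑-Seqs-suc r (λ a → 𝟙 (nbWalk (w₀ ∷ a ++ u ∷ [])))))))))) ⟩
    ∑[ w₀ ∈ Vs ] ∑[ u ∈ Vs ] suc n * (𝟙 (adj u w₀) * nbWalksBetween w₀ u (suc r))
      ≤⟨ ∑-mono Vs (λ w₀ → ∑-mono Vs (λ u → *-monoʳ-≤ (suc n) (*-monoʳ-≤ (𝟙 (adj u w₀)) (nbWalksBetween-≤ w₀ u r)))) ⟩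
    ∑[ w₀ ∈ Vs ] ∑[ u ∈ Vs ] suc n * (𝟙 (adj u w₀) * suc n ^ r)
      ≡⟨ ∑-cong Vs (λ w₀ → trans (∑-*ˡ Vs (suc n) _) (cong (suc n *_)
           (trans (∑-*ʳ Vs (suc n ^ r) (λ u → 𝟙 (adj u w₀))) (cong (_* suc n ^ r) (degree-to w₀))))) ⟩
    ∑[ w₀ ∈ Vs ] suc n ^ (2 + r)
      ≡⟨ ∑-const Vs _ ⟩
    v * suc n ^ (2 + r) ∎
    where
    open ≤-Reasoning
    Ends : X → X → List X → X → ℕ
    Ends w₀ w₁ mid u = 𝟙 (adj u w₀) * 𝟙 (nbWalk (w₀ ∷ w₁ ∷ mid ++ u ∷ []))
    drop-last : ∀ w₀ w₁ mid u w → 𝟙 (nbPrefix w₀ w₁ mid u w) * 𝟙 (adj u w₀) ≤ 𝟙 (adj u w) * Ends w₀ w₁ mid u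
    drop-last w₀ w₁ mid u w = 𝟙*𝟙-≤ (nbPrefix w₀ w₁ mid u w) (adj u w₀) (λ p u~w₀ →
      *-mono-≤ (𝟙-pos (proj₁ (prefix-edges w₀ w₁ mid u w p))) (*-mono-≤ (𝟙-pos u~w₀) (𝟙-pos
        (nbWalk-prefix (w₀ ∷ w₁ ∷ mid ++ u ∷ []) (w ∷ [])
          (subst (T ∘ nbWalk ∘ (λ t → w₀ ∷ w₁ ∷ t)) (sym (++-assoc mid (u ∷ []) (w ∷ []))) p)))))

  nbWalks-returning-≤ : ∀ r x →
    ∑[ mid ∈ Seqs r ] ∑[ u ∈ Vs ] ∑[ w ∈ Vs ] 𝟙 (adj w x) * 𝟙 (nbWalk (x ∷ mid ++ u ∷ w ∷ [])) ≤ suc n ^ (1 + r)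
  nbWalks-returning-≤ r x = begin
    ∑[ mid ∈ Seqs r ] ∑[ u ∈ Vs ] ∑[ w ∈ Vs ] 𝟙 (adj w x) * 𝟙 (nbWalk (x ∷ mid ++ u ∷ w ∷ []))
      ≡⟨ trans (∑-cong (Seqs r) (λ mid → ∑-comm Vs Vs _)) (∑-comm (Seqs r) Vs _) ⟩
    ∑[ w ∈ Vs ] ∑[ mid ∈ Seqs r ] ∑[ u ∈ Vs ] 𝟙 (adj w x) * 𝟙 (nbWalk (x ∷ mid ++ u ∷ w ∷ []))
      ≡⟨ ∑-cong Vs (λ w → trans (∑-cong (Seqs r) (λ mid → ∑-*ˡ Vs (𝟙 (adj w x)) _))
           (trans (∑-*ˡ (Seqs r) (𝟙 (adj w x)) _) (cong (𝟙 (adj w x) *_) (sym (walks w))))) ⟩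
    ∑[ w ∈ Vs ] 𝟙 (adj w x) * nbWalksBetween x w (suc r)
      ≤⟨ ∑-mono Vs (λ w → *-monoʳ-≤ (𝟙 (adj w x)) (nbWalksBetween-≤ x w r)) ⟩
    ∑[ w ∈ Vs ] 𝟙 (adj w x) * suc n ^ r
      ≡⟨ trans (∑-*ʳ Vs (suc n ^ r) (λ w → 𝟙 (adj w x))) (cong (_* suc n ^ r) (degree-to x)) ⟩
    suc n ^ (1 + r) ∎
    where
    open ≤-Reasoning
    walks : ∀ w → nbWalksBetween x w (suc r) ≡ ∑[ mid ∈ Seqs r ] ∑[ u ∈ Vs ] 𝟙 (nbWalk (x ∷ mid ++ u ∷ w ∷ []))
    walks w = trans (∑-Seqs-snoc r (λ a → 𝟙 (nbWalk (x ∷ a ++ w ∷ []))))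
                    (∑-cong (Seqs r) (λ mid → ∑-cong Vs (λ u →
                       cong (λ t → 𝟙 (nbWalk (x ∷ t))) (++-assoc mid (u ∷ []) (w ∷ [])))))

  nbPrefixes-w~w₁ : ∀ r → ∑prefix r (λ w₀ w₁ mid u w → 𝟙 (nbPrefix w₀ w₁ mid u w) * 𝟙 (adj w w₁)) ≤
                          v * suc n ^ (2 + r)
  nbPrefixes-w~w₁ r = begin
    ∑prefix r (λ w₀ w₁ mid u w → 𝟙 (nbPrefix w₀ w₁ mid u w) * 𝟙 (adj w w₁))
      ≤⟨ ∑prefix-mono r drop-first ⟩
    ∑prefix r (λ w₀ w₁ mid u w → 𝟙 (adj w₀ w₁) * Ends w₁ mid u w)
      ≡⟨ ∑-cong Vs (λ w₀ → ∑-cong Vs (λ w₁ → trans (∑-cong (Seqs r) (λ mid →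
           trans (∑-cong Vs (λ u → ∑-*ˡ Vs (𝟙 (adj w₀ w₁)) _)) (∑-*ˡ Vs (𝟙 (adj w₀ w₁)) _)))
                                                  (∑-*ˡ (Seqs r) (𝟙 (adj w₀ w₁)) _))) ⟩
    ∑[ w₀ ∈ Vs ] ∑[ w₁ ∈ Vs ] 𝟙 (adj w₀ w₁) * Returning w₁
      ≡⟨ ∑-comm Vs Vs _ ⟩
    ∑[ w₁ ∈ Vs ] ∑[ w₀ ∈ Vs ] 𝟙 (adj w₀ w₁) * Returning w₁
      ≡⟨ ∑-cong Vs (λ w₁ → trans (∑-*ʳ Vs (Returning w₁) (λ w₀ → 𝟙 (adj w₀ w₁)))
                                 (cong (_* Returning w₁) (degree-to w₁))) ⟩
    ∑[ w₁ ∈ Vs ] suc n * Returning w₁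
      ≤⟨ ∑-mono Vs (λ w₁ → *-monoʳ-≤ (suc n) (nbWalks-returning-≤ r w₁)) ⟩
    ∑[ w₁ ∈ Vs ] suc n ^ (2 + r)
      ≡⟨ ∑-const Vs _ ⟩
    v * suc n ^ (2 + r) ∎
    where
    open ≤-Reasoning
    Ends : X → List X → X → X → ℕ
    Ends w₁ mid u w = 𝟙 (adj w w₁) * 𝟙 (nbWalk (w₁ ∷ mid ++ u ∷ w ∷ []))
    Returning : X → ℕ
    Returning w₁ = ∑[ mid ∈ Seqs r ] ∑[ u ∈ Vs ] ∑[ w ∈ Vs ] Ends w₁ mid u w
    drop-first : ∀ w₀ w₁ mid u w → 𝟙 (nbPrefix w₀ w₁ mid u w) * 𝟙 (adj w w₁) ≤ 𝟙 (adj w₀ w₁) * Ends w₁ mid u w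
    drop-first w₀ w₁ mid u w = 𝟙*𝟙-≤ (nbPrefix w₀ w₁ mid u w) (adj w w₁) (λ p w~w₁ →
      *-mono-≤ (𝟙-pos (proj₂ (prefix-edges w₀ w₁ mid u w p)))
               (*-mono-≤ (𝟙-pos w~w₁) (𝟙-pos (nbWalk-tail w₀ (w₁ ∷ mid ++ u ∷ w ∷ []) p))))

  nbPrefixes-w≡w₀ : ∀ r → ∑prefix r (λ w₀ w₁ mid u w → 𝟙 (nbPrefix w₀ w₁ mid u w ∧ eq w₀ w)) ≤ v * suc n ^ (1 + r)
  nbPrefixes-w≡w₀ r = begin
    ∑prefix r (λ w₀ w₁ mid u w → 𝟙 (nbPrefix w₀ w₁ mid u w ∧ eq w₀ w))
      ≡⟨ ∑prefix-cong r (λ w₀ w₁ mid u w → trans (𝟙-∧ (nbPrefix w₀ w₁ mid u w) (eq w₀ w)) (*-comm _ (𝟙 (eq w₀ w)))) ⟩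
    ∑prefix r (λ w₀ w₁ mid u w → 𝟙 (eq w₀ w) * 𝟙 (nbPrefix w₀ w₁ mid u w))
      ≡⟨ ∑-cong Vs (λ w₀ → trans (∑-cong Vs (λ w₁ → ∑-cong (Seqs r) (λ mid → ∑-cong Vs (λ u →
           ∑-select w₀ (λ w → 𝟙 (nbPrefix w₀ w₁ mid u w)))))) (sym (loops w₀))) ⟩
    ∑[ w₀ ∈ Vs ] nbWalksBetween w₀ w₀ (2 + r)
      ≤⟨ ∑-mono Vs (λ w₀ → nbWalksBetween-≤ w₀ w₀ (1 + r)) ⟩
    ∑[ w₀ ∈ Vs ] suc n ^ (1 + r)
      ≡⟨ ∑-const Vs _ ⟩
    v * suc n ^ (1 + r) ∎
    where
    open ≤-Reasoning
    loops : ∀ w₀ → nbWalksBetween w₀ w₀ (2 + r) ≡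
                   ∑[ w₁ ∈ Vs ] ∑[ mid ∈ Seqs r ] ∑[ u ∈ Vs ] 𝟙 (nbPrefix w₀ w₁ mid u w₀)
    loops w₀ = trans (∑-Seqs-suc (1 + r) (λ a → 𝟙 (nbWalk (w₀ ∷ a ++ w₀ ∷ [])))) (∑-cong Vs (λ w₁ →
               trans (∑-Seqs-snoc r (λ a → 𝟙 (nbWalk (w₀ ∷ w₁ ∷ a ++ w₀ ∷ []))))
                     (∑-cong (Seqs r) (λ mid → ∑-cong Vs (λ u →
                        cong (λ t → 𝟙 (nbWalk (w₀ ∷ w₁ ∷ t))) (++-assoc mid (u ∷ []) (w₀ ∷ [])))))))

  pathTo-last : ∀ f l z → T (pathTo adj f (l ++ z ∷ [])) → T (adj z f)
  pathTo-last f []          z p = p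
  pathTo-last f (a ∷ [])    z p = proj₂ (∧-elim (adj a z) p)
  pathTo-last f (a ∷ b ∷ l) z p = pathTo-last f (b ∷ l) z (proj₂ (∧-elim (adj a b) p))

  module _ (w₀ w₁ : X) (mid : List X) (u w c₁ c₂ c₃ : X) where

    private
      rest : List X
      rest = w₁ ∷ mid ++ u ∷ w ∷ c₁ ∷ c₂ ∷ c₃ ∷ []

      s : List X
      s = w₀ ∷ rest

      s≡prefix++ : s ≡ prefix w₀ w₁ mid u w ++ c₁ ∷ c₂ ∷ c₃ ∷ []
      s≡prefix++ = cong (λ t → w₀ ∷ w₁ ∷ t) (sym (++-assoc mid (u ∷ w ∷ []) (c₁ ∷ c₂ ∷ c₃ ∷ [])))

      closingWalk : List X
      closingWalk = u ∷ w ∷ c₁ ∷ c₂ ∷ c₃ ∷ w₀ ∷ w₁ ∷ []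

    cycleSeq⁻ : T (isCycleSeq s) → T (nbPrefix w₀ w₁ mid u w) × T (nbWalk closingWalk)
    cycleSeq⁻ cyc =
      nbWalk-prefix (prefix w₀ w₁ mid u w) (c₁ ∷ c₂ ∷ c₃ ∷ []) (subst (T ∘ nbWalk) s≡prefix++ nb-s) ,
      nbWalk-glue (u ∷ w ∷ c₁ ∷ []) c₂ c₃ (w₀ ∷ w₁ ∷ []) nb-end
        (nbWalk-∷ (w₀ ∷ w₁ ∷ []) c₂~c₃ (≢⇒not-eq (w₀≢c₂ ∘ sym))
        (nbWalk-∷ (w₁ ∷ []) c₃~w₀ (≢⇒not-eq (w₁≢c₃ ∘ sym))
        (nbWalk-∷ [] w₀~w₁ tt tt)))
      where
      dist : T (distinct eq s)
      dist = proj₁ (∧-elim (distinct eq s) cyc)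
      closed : T (closedWalk adj s)
      closed = proj₂ (∧-elim (distinct eq s) cyc)
      nb-s : T (nbWalk s)
      nb-s = distinct-walk⇒nbWalk s (walk-prefix s (w₀ ∷ []) (pathTo⇒walk w₀ w₀ rest closed)) dist
      nb-end : T (nbWalk (u ∷ w ∷ c₁ ∷ c₂ ∷ c₃ ∷ []))
      nb-end = nbWalk-suffix (w₀ ∷ w₁ ∷ mid) (u ∷ w ∷ c₁ ∷ c₂ ∷ c₃ ∷ []) nb-s
      w₀~w₁ : T (adj w₀ w₁)
      w₀~w₁ = nbWalk-adj w₀ w₁ (mid ++ u ∷ w ∷ c₁ ∷ c₂ ∷ c₃ ∷ []) nb-s
      c₂~c₃ : T (adj c₂ c₃)
      c₂~c₃ = nbWalk-adj c₂ c₃ [] (nbWalk-suffix (u ∷ w ∷ c₁ ∷ []) (c₂ ∷ c₃ ∷ []) nb-end)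
      c₃~w₀ : T (adj c₃ w₀)
      c₃~w₀ = pathTo-last w₀ (w₀ ∷ w₁ ∷ mid ++ u ∷ w ∷ c₁ ∷ c₂ ∷ []) c₃
                (subst (λ t → T (pathTo adj w₀ (w₀ ∷ w₁ ∷ t))) (sym (++-assoc mid (u ∷ w ∷ c₁ ∷ c₂ ∷ []) (c₃ ∷ [])))
                       closed)
      w₀≢c₂ : w₀ ≢ c₂
      w₀≢c₂ = distinct-∷⁻ w₀ (w₁ ∷ mid ++ u ∷ w ∷ c₁ ∷ []) c₂ (c₃ ∷ [])
                (subst (λ t → T (distinct eq (w₀ ∷ w₁ ∷ t))) (sym (++-assoc mid (u ∷ w ∷ c₁ ∷ []) (c₂ ∷ c₃ ∷ [])))
                       dist)
      w₁≢c₃ : w₁ ≢ c₃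
      w₁≢c₃ = distinct-∷⁻ w₁ (mid ++ u ∷ w ∷ c₁ ∷ c₂ ∷ []) c₃ []
                (subst (λ t → T (distinct eq (w₁ ∷ t))) (sym (++-assoc mid (u ∷ w ∷ c₁ ∷ c₂ ∷ []) (c₃ ∷ [])))
                       (proj₂ (∧-elim (not (any (eq w₀) rest)) dist)))

    closedNB-glue : T (nbPrefix w₀ w₁ mid u w) → T (nbWalk closingWalk) → T (closedNB s)
    closedNB-glue p c = subst (T ∘ nbWalk) (sym s++s)
      (nbWalk-glue (w₀ ∷ w₁ ∷ mid) u w (c₁ ∷ c₂ ∷ c₃ ∷ s) p
        (nbWalk-glue (u ∷ w ∷ c₁ ∷ c₂ ∷ c₃ ∷ []) w₀ w₁ (mid ++ u ∷ w ∷ c₁ ∷ c₂ ∷ c₃ ∷ []) c nb-s))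
      where
      nb-s : T (nbWalk s)
      nb-s = nbWalk-glue (w₀ ∷ w₁ ∷ mid) u w (c₁ ∷ c₂ ∷ c₃ ∷ []) p
               (nbWalk-prefix (u ∷ w ∷ c₁ ∷ c₂ ∷ c₃ ∷ []) (w₀ ∷ w₁ ∷ []) c)
      s++s : s ++ s ≡ (w₀ ∷ w₁ ∷ mid) ++ u ∷ w ∷ c₁ ∷ c₂ ∷ c₃ ∷ s
      s++s = cong (λ t → w₀ ∷ w₁ ∷ t) (++-assoc mid (u ∷ w ∷ c₁ ∷ c₂ ∷ c₃ ∷ []) s)

  closedNB-≤ : ∀ x t → 𝟙 (closedNB (x ∷ t)) ≤
                       𝟙 (isCycleSeq (x ∷ t)) + 𝟙 (closedNB (x ∷ t) ∧ not (distinct eq (x ∷ t)))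
  closedNB-≤ x t with T? (closedNB (x ∷ t)) | T? (distinct eq (x ∷ t))
  ... | no ¬c | _      = ≤-trans (≤-reflexive (𝟙-false ¬c)) z≤n
  ... | yes c | yes d  = ≤-trans (𝟙-mono (λ _ → ∧-intro d (closedNB⇒closedWalk x t c))) (m≤m+n _ _)
  ... | yes c | no ¬d  = ≤-trans (𝟙-mono (λ _ → ∧-intro c (not-intro ¬d))) (m≤n+m _ _)

  prefixClosings : ℕ → ℕ
  prefixClosings r = ∑prefix r (λ w₀ w₁ mid u w → 𝟙 (nbPrefix w₀ w₁ mid u w) * closings u w w₀ w₁)

  ∑-closings : ∀ k u w w₀ w₁ →
    ∑[ c₁ ∈ Vs ] ∑[ c₂ ∈ Vs ] ∑[ c₃ ∈ Vs ] k * 𝟙 (nbWalk (u ∷ w ∷ c₁ ∷ c₂ ∷ c₃ ∷ w₀ ∷ w₁ ∷ [])) ≡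
    k * closings u w w₀ w₁
  ∑-closings k u w w₀ w₁ =
    trans (∑-cong Vs (λ c₁ → trans (∑-cong Vs (λ c₂ → ∑-*ˡ Vs k _)) (∑-*ˡ Vs k _))) (∑-*ˡ Vs k _)

  cycleSeqs : ℕ → ℕ
  cycleSeqs m = ∑[ s ∈ Seqs m ] 𝟙 (isCycleSeq s)

  cycleSeqs-≤-prefixClosings : ∀ r → cycleSeqs (7 + r) ≤ prefixClosings r
  cycleSeqs-≤-prefixClosings r = begin
    cycleSeqs (7 + r)
      ≡⟨ ∑-Seqs-7+ r (𝟙 ∘ isCycleSeq) ⟩
    ∑prefix r (λ w₀ w₁ mid u w → ∑[ c₁ ∈ Vs ] ∑[ c₂ ∈ Vs ] ∑[ c₃ ∈ Vs ]
                 𝟙 (isCycleSeq (w₀ ∷ w₁ ∷ mid ++ u ∷ w ∷ c₁ ∷ c₂ ∷ c₃ ∷ [])))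
      ≤⟨ ∑prefix-mono r (λ w₀ w₁ mid u w → ∑-mono Vs (λ c₁ → ∑-mono Vs (λ c₂ → ∑-mono Vs (λ c₃ →
           𝟙-≤-* (cycleSeq⁻ w₀ w₁ mid u w c₁ c₂ c₃))))) ⟩
    ∑prefix r (λ w₀ w₁ mid u w → ∑[ c₁ ∈ Vs ] ∑[ c₂ ∈ Vs ] ∑[ c₃ ∈ Vs ]
                 𝟙 (nbPrefix w₀ w₁ mid u w) * 𝟙 (nbWalk (u ∷ w ∷ c₁ ∷ c₂ ∷ c₃ ∷ w₀ ∷ w₁ ∷ [])))
      ≡⟨ ∑prefix-cong r (λ w₀ w₁ mid u w → ∑-closings (𝟙 (nbPrefix w₀ w₁ mid u w)) u w w₀ w₁) ⟩
    prefixClosings r ∎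
    where open ≤-Reasoning

  prefixClosings-≤-closedNBs : ∀ r → prefixClosings r ≤ ∑[ s ∈ Seqs (7 + r) ] 𝟙 (closedNB s)
  prefixClosings-≤-closedNBs r = begin
    prefixClosings r
      ≡⟨ ∑prefix-cong r (λ w₀ w₁ mid u w → ∑-closings (𝟙 (nbPrefix w₀ w₁ mid u w)) u w w₀ w₁) ⟨
    ∑prefix r (λ w₀ w₁ mid u w → ∑[ c₁ ∈ Vs ] ∑[ c₂ ∈ Vs ] ∑[ c₃ ∈ Vs ]
                 𝟙 (nbPrefix w₀ w₁ mid u w) * 𝟙 (nbWalk (u ∷ w ∷ c₁ ∷ c₂ ∷ c₃ ∷ w₀ ∷ w₁ ∷ [])))
      ≤⟨ ∑prefix-mono r (λ w₀ w₁ mid u w → ∑-mono Vs (λ c₁ → ∑-mono Vs (λ c₂ → ∑-mono Vs (λ c₃ →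
           𝟙-*-≤ (closedNB-glue w₀ w₁ mid u w c₁ c₂ c₃))))) ⟩
    ∑prefix r (λ w₀ w₁ mid u w → ∑[ c₁ ∈ Vs ] ∑[ c₂ ∈ Vs ] ∑[ c₃ ∈ Vs ]
                 𝟙 (closedNB (w₀ ∷ w₁ ∷ mid ++ u ∷ w ∷ c₁ ∷ c₂ ∷ c₃ ∷ [])))
      ≡⟨ ∑-Seqs-7+ r (𝟙 ∘ closedNB) ⟨
    ∑[ s ∈ Seqs (7 + r) ] 𝟙 (closedNB s) ∎
    where open ≤-Reasoning

  closedNBs-≤ : ∀ m → ∑[ s ∈ Seqs (suc m) ] 𝟙 (closedNB s) ≤
                      cycleSeqs (suc m) + (∑[ s ∈ Seqs (suc m) ] 𝟙 (closedNB s ∧ not (distinct eq s)))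
  closedNBs-≤ m = ≤-trans (∑-Seqs-mono (suc m) nonempty) (≤-reflexive (∑-+ (Seqs (suc m)) _ _))
    where
    nonempty : ∀ s → length s ≡ suc m →
               𝟙 (closedNB s) ≤ 𝟙 (isCycleSeq s) + 𝟙 (closedNB s ∧ not (distinct eq s))
    nonempty (x ∷ t) _ = closedNB-≤ x t

  prefixClosings-≤ : ∀ r → prefixClosings r ≤
    (n ∸ 1) * (n ∸ 1) * (v * (suc n * n ^ (r + 2))) + 2 * (v * suc n ^ (3 + r))
  prefixClosings-≤ r = begin
    prefixClosings r
      ≤⟨ ∑prefix-mono r (λ w₀ w₁ mid u w → 𝟙*-mono (nbPrefix w₀ w₁ mid u w) (λ p →
           let u~w , w₀~w₁ = prefix-edges w₀ w₁ mid u w p in closings-≤ u w w₀ w₁ u~w w₀~w₁)) ⟩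
    ∑prefix r (λ w₀ w₁ mid u w → 𝟙 (nbPrefix w₀ w₁ mid u w) * (Q + suc n * (𝟙 (adj u w₀) + 𝟙 (adj w w₁))))
      ≡⟨ ∑prefix-cong r (λ w₀ w₁ mid u w →
           distribute (𝟙 (nbPrefix w₀ w₁ mid u w)) Q (suc n) (𝟙 (adj u w₀)) (𝟙 (adj w w₁))) ⟩
    ∑prefix r (λ w₀ w₁ mid u w → Q * 𝟙 (nbPrefix w₀ w₁ mid u w) + suc n *
                 (𝟙 (nbPrefix w₀ w₁ mid u w) * 𝟙 (adj u w₀) + 𝟙 (nbPrefix w₀ w₁ mid u w) * 𝟙 (adj w w₁)))
      ≡⟨ trans (∑prefix-+ r _ _) (cong₂ _+_ (∑prefix-*ˡ r Q _)
                                            (trans (∑prefix-*ˡ r (suc n) _) (cong (suc n *_) (∑prefix-+ r _ _)))) ⟩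
    Q * ∑prefix r (λ w₀ w₁ mid u w → 𝟙 (nbPrefix w₀ w₁ mid u w)) + suc n *
      (∑prefix r (λ w₀ w₁ mid u w → 𝟙 (nbPrefix w₀ w₁ mid u w) * 𝟙 (adj u w₀)) +
       ∑prefix r (λ w₀ w₁ mid u w → 𝟙 (nbPrefix w₀ w₁ mid u w) * 𝟙 (adj w w₁)))
      ≤⟨ +-mono-≤ (≤-reflexive (cong (Q *_) (nbPrefixes r)))
                  (*-monoʳ-≤ (suc n) (+-mono-≤ (nbPrefixes-u~w₀ r) (nbPrefixes-w~w₁ r))) ⟩
    Q * (v * (suc n * n ^ (r + 2))) + suc n * (v * suc n ^ (2 + r) + v * suc n ^ (2 + r))
      ≡⟨ cong (Q * (v * (suc n * n ^ (r + 2))) +_) (double (suc n) v (suc n ^ (2 + r))) ⟩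
    Q * (v * (suc n * n ^ (r + 2))) + 2 * (v * suc n ^ (3 + r)) ∎
    where
    open ≤-Reasoning
    Q : ℕ
    Q = (n ∸ 1) * (n ∸ 1)
    distribute : ∀ a q s b c → a * (q + s * (b + c)) ≡ q * a + s * (a * b + a * c)
    distribute = solve-∀
    double : ∀ s v p → s * (v * p + v * p) ≡ 2 * (v * (s * p))
    double = solve-∀

  closings-of-prefix-≥ : ∀ j w₀ w₁ mid u w → length mid ≡ suc (j + j) →
    (n ∸ 1) * (n ∸ 1) * 𝟙 (nbPrefix w₀ w₁ mid u w ∧ not (eq w₀ w)) ≤ 𝟙 (nbPrefix w₀ w₁ mid u w) * closings u w w₀ w₁
  closings-of-prefix-≥ j w₀ w₁ mid u w |mid| with T? (nbPrefix w₀ w₁ mid u w ∧ not (eq w₀ w))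
  ... | no ¬p = ≤-trans (≤-reflexive (trans (cong (Q *_) (𝟙-false ¬p)) (*-zeroʳ Q))) z≤n
    where
    Q : ℕ
    Q = (n ∸ 1) * (n ∸ 1)
  ... | yes p =
    let p-nb , w₀≠w = ∧-elim (nbPrefix w₀ w₁ mid u w) p
        u~w , w₀~w₁ = prefix-edges w₀ w₁ mid u w p-nb
    in begin
      (n ∸ 1) * (n ∸ 1) * 𝟙 (nbPrefix w₀ w₁ mid u w ∧ not (eq w₀ w))
        ≡⟨ trans (cong ((n ∸ 1) * (n ∸ 1) *_) (𝟙-true p)) (*-identityʳ _) ⟩
      (n ∸ 1) * (n ∸ 1)
        ≤⟨ closings-≥ u w w₀ w₁ u~w w₀~w₁ (not-eq⇒≢ w₀≠w ∘ sym) (prefix-sides j w₀ w₁ mid u w |mid| p-nb) ⟩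
      closings u w w₀ w₁
        ≡⟨ +-identityʳ _ ⟨
      1 * closings u w w₀ w₁
        ≡⟨ cong (_* closings u w w₀ w₁) (𝟙-true p-nb) ⟨
      𝟙 (nbPrefix w₀ w₁ mid u w) * closings u w w₀ w₁ ∎
    where open ≤-Reasoning

  prefixClosings-≥ : ∀ {j r} → r ≡ suc (j + j) →
    (n ∸ 1) * (n ∸ 1) * (v * (suc n * n ^ (r + 2))) ≤
    prefixClosings r + (n ∸ 1) * (n ∸ 1) * (v * suc n ^ (1 + r))
  prefixClosings-≥ {j} {r} odd = begin
    Q * (v * (suc n * n ^ (r + 2)))
      ≡⟨ cong (Q *_) (nbPrefixes r) ⟨
    Q * ∑prefix r (λ w₀ w₁ mid u w → 𝟙 (nbPrefix w₀ w₁ mid u w))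
      ≡⟨ cong (Q *_) (trans (∑prefix-cong r (λ w₀ w₁ mid u w → 𝟙-split (nbPrefix w₀ w₁ mid u w) (eq w₀ w)))
                            (∑prefix-+ r _ _)) ⟩
    Q * (∑prefix r (λ w₀ w₁ mid u w → 𝟙 (nbPrefix w₀ w₁ mid u w ∧ not (eq w₀ w))) +
         ∑prefix r (λ w₀ w₁ mid u w → 𝟙 (nbPrefix w₀ w₁ mid u w ∧ eq w₀ w)))
      ≡⟨ *-distribˡ-+ Q _ _ ⟩
    Q * ∑prefix r (λ w₀ w₁ mid u w → 𝟙 (nbPrefix w₀ w₁ mid u w ∧ not (eq w₀ w))) +
    Q * ∑prefix r (λ w₀ w₁ mid u w → 𝟙 (nbPrefix w₀ w₁ mid u w ∧ eq w₀ w))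
      ≤⟨ +-mono-≤ (≤-trans (≤-reflexive (sym (∑prefix-*ˡ r Q _)))
                           (∑prefix-mono-length r (λ w₀ w₁ mid u w |mid| →
                              closings-of-prefix-≥ j w₀ w₁ mid u w (trans |mid| odd))))
                  (*-monoʳ-≤ Q (nbPrefixes-w≡w₀ r)) ⟩
    prefixClosings r + Q * (v * suc n ^ (1 + r)) ∎
    where
    open ≤-Reasoning
    Q : ℕ
    Q = (n ∸ 1) * (n ∸ 1)

  cycleSeqs-≤ : ∀ r → cycleSeqs (7 + r) ≤
                      (n ∸ 1) * (n ∸ 1) * (v * (suc n * n ^ (r + 2))) + 2 * (v * suc n ^ (3 + r))
  cycleSeqs-≤ r = ≤-trans (cycleSeqs-≤-prefixClosings r) (prefixClosings-≤ r)

  cycleSeqs-≥ : ∀ {j r} → r ≡ suc (j + j) →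
    (n ∸ 1) * (n ∸ 1) * (v * (suc n * n ^ (r + 2))) ≤
    cycleSeqs (7 + r) + (7 + r) * ((7 + r) * (v * suc n ^ (3 + r))) + (n ∸ 1) * (n ∸ 1) * (v * suc n ^ (1 + r))
  cycleSeqs-≥ {j} {r} odd =
    ≤-trans (prefixClosings-≥ {j} odd) (+-monoˡ-≤ _ (begin
      prefixClosings r
        ≤⟨ prefixClosings-≤-closedNBs r ⟩
      ∑[ s ∈ Seqs (7 + r) ] 𝟙 (closedNB s)
        ≤⟨ closedNBs-≤ (6 + r) ⟩
      cycleSeqs (7 + r) + (∑[ s ∈ Seqs (7 + r) ] 𝟙 (closedNB s ∧ not (distinct eq s)))
        ≤⟨ +-monoʳ-≤ (cycleSeqs (7 + r)) (repeatedClosedNB-≤ (7 + r)) ⟩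
      cycleSeqs (7 + r) + (7 + r) * ((7 + r) * (v * suc n ^ (3 + r))) ∎))
    where open ≤-Reasoning

-- Projective planes

eqFin : ∀ {k} → Fin k → Fin k → Bool
eqFin a b = ⌊ a ≟ᶠ b ⌋

eqFin-sound : ∀ {k} (a b : Fin k) → T (eqFin a b) → a ≡ b
eqFin-sound a b = toWitness

eqFin-refl : ∀ {k} (a : Fin k) → T (eqFin a a)
eqFin-refl a = fromWitness refl

eqFin-suc : ∀ {k} (a b : Fin k) → eqFin (fsuc a) (fsuc b) ≡ eqFin a b
eqFin-suc a b with a ≟ᶠ b
... | yes _ = refl
... | no  _ = refl

∑-allFin-suc : ∀ k (g : Fin (suc k) → ℕ) → ∑ (allFin (suc k)) g ≡ g fzero + (∑[ i ∈ allFin k ] g (fsuc i))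
∑-allFin-suc k g =
  cong (g fzero +_) (trans (cong (λ xs → ∑ xs g) (sym (map-tabulate id fsuc))) (∑-map fsuc (allFin k) g))

occurs-once-Fin : ∀ k (a : Fin k) → ∑[ i ∈ allFin k ] 𝟙 (eqFin a i) ≡ 1
occurs-once-Fin (suc k) fzero    = trans (∑-allFin-suc k (𝟙 ∘ eqFin fzero)) (cong suc (∑-zero (allFin k)))
occurs-once-Fin (suc k) (fsuc a) =
  trans (∑-allFin-suc k (𝟙 ∘ eqFin (fsuc a)))
        (trans (∑-cong (allFin k) (λ i → cong 𝟙 (eqFin-suc a i))) (occurs-once-Fin k a))

∑-allFin-const : ∀ k c → ∑[ i ∈ allFin k ] c ≡ k * c
∑-allFin-const k c = trans (∑-const (allFin k) c) (cong (_* c) (length-tabulate {n = k} id))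

module ProjectivePlaneCounting {p l : ℕ} (Π : ProjectivePlane p l) (n : ℕ) (order : HasOrder Π n) where

  module Points = Counting (allFin p) eqFin eqFin-sound eqFin-refl (occurs-once-Fin p)
  module Lines  = Counting (allFin l) eqFin eqFin-sound eqFin-refl (occurs-once-Fin l)

  on : Fin p → Fin l → Bool
  on = I Π

  T-on : ∀ {P m} → T (on P m) → I Π P m ≡ true
  T-on = Equivalence.to T-≡

  on-T : ∀ {P m} → I Π P m ≡ true → T (on P m)
  on-T = Equivalence.from T-≡

  points-on : ∀ m → Points.count (λ Q → on Q m) ≡ suc n
  points-on m = trans (sym (length-filter (λ Q → on Q m) (allFin p))) (order m)

  line-avoiding : ∀ P → ∃[ m ] ¬ T (on P m)
  line-avoiding P with quad Π
  ... | a , b , c , d , a≢b , a≢c , _ , _ , _ , c≢d , no-abc , _ , no-acd , _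
    with join Π a b a≢b | join Π c d c≢d | join Π a c a≢c
  ... | ab , a∈ab , b∈ab | cd , c∈cd , d∈cd | ac , a∈ac , c∈ac
    with T? (on P ab) | T? (on P cd) | T? (on P ac)
  ... | no P∉ab  | _        | _        = ab , P∉ab
  ... | yes _    | no P∉cd  | _        = cd , P∉cd
  ... | yes _    | yes _    | no P∉ac  = ac , P∉ac
  ... | yes P∈ab | yes P∈cd | yes P∈ac = ⊥-elim (a≢c (trans (sym P≡a) P≡c))
    where
    ab≢ac : ab ≢ ac
    ab≢ac ab≡ac = no-abc ab (a∈ab , b∈ab , subst (λ m → I Π c m ≡ true) (sym ab≡ac) c∈ac)
    cd≢ac : cd ≢ ac
    cd≢ac cd≡ac = no-acd ac (a∈ac , c∈ac , subst (λ m → I Π d m ≡ true) cd≡ac d∈cd)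
    P≡a : P ≡ a
    P≡a = meet-uniq Π ab ac ab≢ac P a (T-on P∈ab) (T-on P∈ac) a∈ab a∈ac
    P≡c : P ≡ c
    P≡c = meet-uniq Π cd ac cd≢ac P c (T-on P∈cd) (T-on P∈ac) c∈cd c∈ac

  meeting-point : ∀ m k → m ≢ k → Points.count (λ Q → on Q m ∧ on Q k) ≡ 1
  meeting-point m k m≢k =
    let Q₀ , Q₀∈m , Q₀∈k = meet Π m k m≢k
    in Points.count-unique _ Q₀ (∧-intro (on-T Q₀∈m) (on-T Q₀∈k)) (λ Q Q∈ →
         let Q∈m , Q∈k = ∧-elim (on Q m) Q∈ in meet-uniq Π m k m≢k Q Q₀ (T-on Q∈m) (T-on Q∈k) Q₀∈m Q₀∈k)

  joining-line : ∀ P Q → P ≢ Q → Lines.count (λ m → on P m ∧ on Q m) ≡ 1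
  joining-line P Q P≢Q =
    let m₀ , P∈m₀ , Q∈m₀ = join Π P Q P≢Q
    in Lines.count-unique _ m₀ (∧-intro (on-T P∈m₀) (on-T Q∈m₀)) (λ m PQ∈m →
         let P∈m , Q∈m = ∧-elim (on P m) PQ∈m in join-uniq Π P Q P≢Q m m₀ (T-on P∈m) (T-on Q∈m) P∈m₀ Q∈m₀)

  -- The lines through P correspond to the points of a line m₀ avoiding P.
  lines-through : ∀ P → Lines.count (on P) ≡ suc n
  lines-through P = begin
    Lines.count (on P)
      ≡⟨ ∑-cong (allFin l) meets-m₀ ⟩
    ∑[ m ∈ allFin l ] 𝟙 (on P m) * Points.count (λ Q → on Q m ∧ on Q m₀)
      ≡⟨ ∑-cong (allFin l) (λ m → sym (∑-*ˡ (allFin p) (𝟙 (on P m)) _)) ⟩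
    ∑[ m ∈ allFin l ] ∑[ Q ∈ allFin p ] 𝟙 (on P m) * 𝟙 (on Q m ∧ on Q m₀)
      ≡⟨ ∑-comm (allFin l) (allFin p) _ ⟩
    ∑[ Q ∈ allFin p ] ∑[ m ∈ allFin l ] 𝟙 (on P m) * 𝟙 (on Q m ∧ on Q m₀)
      ≡⟨ ∑-cong (allFin p) (λ Q → trans (∑-cong (allFin l) (λ m → rotate (on P m) (on Q m) (on Q m₀)))
                                        (∑-*ˡ (allFin l) (𝟙 (on Q m₀)) _)) ⟩
    ∑[ Q ∈ allFin p ] 𝟙 (on Q m₀) * Lines.count (λ m → on P m ∧ on Q m)
      ≡⟨ ∑-cong (allFin p) joined-to-P ⟩
    Points.count (λ Q → on Q m₀)
      ≡⟨ points-on m₀ ⟩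
    suc n ∎
    where
    open ≡-Reasoning
    m₀ : Fin l
    m₀ = proj₁ (line-avoiding P)
    P∉m₀ : ¬ T (on P m₀)
    P∉m₀ = proj₂ (line-avoiding P)
    rotate : ∀ a b c → 𝟙 a * 𝟙 (b ∧ c) ≡ 𝟙 c * 𝟙 (a ∧ b)
    rotate true  true  true  = refl
    rotate true  true  false = refl
    rotate true  false c     = sym (*-zeroʳ (𝟙 c))
    rotate false b     c     = sym (*-zeroʳ (𝟙 c))
    meets-m₀ : ∀ m → 𝟙 (on P m) ≡ 𝟙 (on P m) * Points.count (λ Q → on Q m ∧ on Q m₀)
    meets-m₀ m with on P m in P∈m
    ... | false = refl
    ... | true  = sym (trans (+-identityʳ _)
                             (meeting-point m m₀ (λ m≡m₀ → P∉m₀ (subst (T ∘ on P) m≡m₀ (on-T P∈m)))))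
    joined-to-P : ∀ Q → 𝟙 (on Q m₀) * Lines.count (λ m → on P m ∧ on Q m) ≡ 𝟙 (on Q m₀)
    joined-to-P Q with on Q m₀ in Q∈m₀
    ... | false = refl
    ... | true  = trans (+-identityʳ _)
                        (joining-line P Q (λ P≡Q → P∉m₀ (subst (λ R → T (on R m₀)) (sym P≡Q) (on-T Q∈m₀))))

  -- Every point other than P₀ is joined to P₀ by exactly one line, which carries n of them.
  points-count : p ≡ suc (suc n * n)
  points-count = begin
    p
      ≡⟨ trans (∑-allFin-const p 1) (*-identityʳ p) ⟨
    ∑[ Q ∈ allFin p ] 1
      ≡⟨ ∑-cong (allFin p) split ⟩
    ∑[ Q ∈ allFin p ] 𝟙 (eqFin P₀ Q) + Lines.count (λ m → on P₀ m ∧ (on Q m ∧ not (eqFin P₀ Q)))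
      ≡⟨ ∑-+ (allFin p) _ _ ⟩
    Points.count (eqFin P₀) + (∑[ Q ∈ allFin p ] ∑[ m ∈ allFin l ] 𝟙 (on P₀ m ∧ (on Q m ∧ not (eqFin P₀ Q))))
      ≡⟨ cong₂ _+_ (occurs-once-Fin p P₀) (∑-comm (allFin p) (allFin l) _) ⟩
    1 + (∑[ m ∈ allFin l ] ∑[ Q ∈ allFin p ] 𝟙 (on P₀ m ∧ (on Q m ∧ not (eqFin P₀ Q))))
      ≡⟨ cong suc (∑-cong (allFin l) others-on) ⟩
    1 + (∑[ m ∈ allFin l ] 𝟙 (on P₀ m) * n)
      ≡⟨ cong suc (trans (∑-*ʳ (allFin l) n (𝟙 ∘ on P₀)) (cong (_* n) (lines-through P₀))) ⟩
    suc (suc n * n) ∎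
    where
    open ≡-Reasoning
    P₀ : Fin p
    P₀ = proj₁ (quad Π)
    split : ∀ Q → 1 ≡ 𝟙 (eqFin P₀ Q) + Lines.count (λ m → on P₀ m ∧ (on Q m ∧ not (eqFin P₀ Q)))
    split Q with eqFin P₀ Q in P₀=Q
    ... | true  = sym (cong suc (Lines.count-zero _ (λ m t →
                    proj₂ (∧-elim (on Q m) (proj₂ (∧-elim (on P₀ m) t))))))
    ... | false = sym (trans (∑-cong (allFin l) (λ m → cong (λ b → 𝟙 (on P₀ m ∧ b)) (∧-identityʳ (on Q m))))
                             (joining-line P₀ Q P₀≢Q))
      where
      P₀≢Q : P₀ ≢ Q
      P₀≢Q P₀≡Q = subst T P₀=Q (subst (T ∘ eqFin P₀) P₀≡Q (eqFin-refl P₀))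
    others-on : ∀ m → ∑[ Q ∈ allFin p ] 𝟙 (on P₀ m ∧ (on Q m ∧ not (eqFin P₀ Q))) ≡ 𝟙 (on P₀ m) * n
    others-on m with on P₀ m in P₀∈m
    ... | false = ∑-zero (allFin p)
    ... | true  = trans (suc-injective (trans (sym (Points.count-remove (λ Q → on Q m) P₀ (on-T P₀∈m)))
                                              (points-on m)))
                        (sym (+-identityʳ n))

  -- Counting incidences by points and by lines.
  points≡lines : p ≡ l
  points≡lines = *-cancelʳ-≡ p l (suc n) (begin
    p * suc n
      ≡⟨ ∑-allFin-const p (suc n) ⟨
    ∑[ P ∈ allFin p ] suc n
      ≡⟨ ∑-cong (allFin p) lines-through ⟨
    ∑[ P ∈ allFin p ] ∑[ m ∈ allFin l ] 𝟙 (on P m)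
      ≡⟨ ∑-comm (allFin p) (allFin l) _ ⟩
    ∑[ m ∈ allFin l ] ∑[ P ∈ allFin p ] 𝟙 (on P m)
      ≡⟨ ∑-cong (allFin l) points-on ⟩
    ∑[ m ∈ allFin l ] suc n
      ≡⟨ ∑-allFin-const l (suc n) ⟩
    l * suc n ∎)
    where open ≡-Reasoning

module LeviGraph {p l : ℕ} (Π : ProjectivePlane p l) (n : ℕ) (order : HasOrder Π n) where

  open ProjectivePlaneCounting Π n order

  ∑-Levi : ∀ (f : LeviV p l → ℕ) →
           ∑ (leviVertices p l) f ≡ (∑[ P ∈ allFin p ] f (inj₁ P)) + (∑[ m ∈ allFin l ] f (inj₂ m))
  ∑-Levi f = trans (∑-++ (map inj₁ (allFin p)) (map inj₂ (allFin l)) f)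
                   (cong₂ _+_ (∑-map inj₁ (allFin p) f) (∑-map inj₂ (allFin l) f))

  isPoint : LeviV p l → Bool
  isPoint (inj₁ _) = true
  isPoint (inj₂ _) = false

  eqV-sound : ∀ (x y : LeviV p l) → T (eqV x y) → x ≡ y
  eqV-sound (inj₁ P) (inj₁ Q) P=Q = cong inj₁ (eqFin-sound P Q P=Q)
  eqV-sound (inj₂ m) (inj₂ k) m=k = cong inj₂ (eqFin-sound m k m=k)

  eqV-refl : ∀ (x : LeviV p l) → T (eqV x x)
  eqV-refl (inj₁ P) = eqFin-refl P
  eqV-refl (inj₂ m) = eqFin-refl m

  eqV-occurs-once : ∀ (x : LeviV p l) → ∑[ y ∈ leviVertices p l ] 𝟙 (eqV x y) ≡ 1
  eqV-occurs-once (inj₁ P) = trans (∑-Levi (𝟙 ∘ eqV (inj₁ P))) (cong₂ _+_ (occurs-once-Fin p P) (∑-zero (allFin l)))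
  eqV-occurs-once (inj₂ m) = trans (∑-Levi (𝟙 ∘ eqV (inj₂ m))) (cong₂ _+_ (∑-zero (allFin p)) (occurs-once-Fin l m))

  leviAdj-degree : ∀ (x : LeviV p l) → ∑[ y ∈ leviVertices p l ] 𝟙 (leviAdj Π x y) ≡ suc n
  leviAdj-degree (inj₁ P) =
    trans (∑-Levi (𝟙 ∘ leviAdj Π (inj₁ P))) (cong₂ _+_ (∑-zero (allFin p)) (lines-through P))
  leviAdj-degree (inj₂ m) =
    trans (∑-Levi (𝟙 ∘ leviAdj Π (inj₂ m))) (trans (cong₂ _+_ (points-on m) (∑-zero (allFin l))) (+-identityʳ (suc n)))

  leviAdj-sym : ∀ (x y : LeviV p l) → leviAdj Π x y ≡ leviAdj Π y x
  leviAdj-sym (inj₁ _) (inj₁ _) = refl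
  leviAdj-sym (inj₁ _) (inj₂ _) = refl
  leviAdj-sym (inj₂ _) (inj₁ _) = refl
  leviAdj-sym (inj₂ _) (inj₂ _) = refl

  leviAdj-side : ∀ (x y : LeviV p l) → T (leviAdj Π x y) → isPoint y ≡ not (isPoint x)
  leviAdj-side (inj₁ _) (inj₂ _) _ = refl
  leviAdj-side (inj₂ _) (inj₁ _) _ = refl

  common-unique : ∀ (x y z w : LeviV p l) → x ≢ y → T (leviAdj Π x z) → T (leviAdj Π y z) →
                  T (leviAdj Π x w) → T (leviAdj Π y w) → z ≡ w
  common-unique (inj₁ P) (inj₁ Q) (inj₂ m) (inj₂ k) P≢Q P∈m Q∈m P∈k Q∈k =
    cong inj₂ (join-uniq Π P Q (P≢Q ∘ cong inj₁) m k (T-on P∈m) (T-on Q∈m) (T-on P∈k) (T-on Q∈k))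
  common-unique (inj₂ m) (inj₂ k) (inj₁ P) (inj₁ Q) m≢k P∈m P∈k Q∈m Q∈k =
    cong inj₁ (meet-uniq Π m k (m≢k ∘ cong inj₂) P Q (T-on P∈m) (T-on P∈k) (T-on Q∈m) (T-on Q∈k))
  common-unique (inj₁ _) (inj₁ _) (inj₂ _) (inj₁ _) _ _ _ () _
  common-unique (inj₂ _) (inj₂ _) (inj₁ _) (inj₂ _) _ _ _ () _
  common-unique (inj₁ _) (inj₂ _) (inj₂ _) _ _ _ () _ _
  common-unique (inj₂ _) (inj₁ _) (inj₁ _) _ _ _ () _ _

  common-exists : ∀ (x y : LeviV p l) → x ≢ y → isPoint x ≡ isPoint y →
                  ∃[ z ] (T (leviAdj Π x z) × T (leviAdj Π y z))
  common-exists (inj₁ P) (inj₁ Q) P≢Q _ =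
    let m , P∈m , Q∈m = join Π P Q (P≢Q ∘ cong inj₁) in inj₂ m , on-T P∈m , on-T Q∈m
  common-exists (inj₂ m) (inj₂ k) m≢k _ =
    let P , P∈m , P∈k = meet Π m k (m≢k ∘ cong inj₂) in inj₁ P , on-T P∈m , on-T P∈k

  open GeneralizedTriangle (leviVertices p l) (eqV {p} {l}) (leviAdj Π) isPoint n eqV-sound eqV-refl eqV-occurs-once
         leviAdj-degree leviAdj-sym leviAdj-side common-unique common-exists public

  cycleSeqCount≡cycleSeqs : ∀ m → cycleSeqCount (leviVertices p l) eqV (leviAdj Π) m ≡ cycleSeqs m
  cycleSeqCount≡cycleSeqs m = length-filter isCycleSeq (Seqs m)

  levi-size : v ≡ 2 * suc (suc n * n)
  levi-size = begin
    length (map inj₁ (allFin p) ++ map inj₂ (allFin l))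
      ≡⟨ length-++ (map inj₁ (allFin p)) ⟩
    length (map inj₁ (allFin p)) + length (map inj₂ (allFin l))
      ≡⟨ cong₂ _+_ (trans (length-map inj₁ (allFin p)) (length-tabulate {n = p} id))
                   (trans (length-map inj₂ (allFin l)) (length-tabulate {n = l} id)) ⟩
    p + l
      ≡⟨ cong₂ _+_ points-count (trans (sym points≡lines) points-count) ⟩
    suc (suc n * n) + suc (suc n * n)
      ≡⟨ cong (suc (suc n * n) +_) (+-identityʳ _) ⟨
    2 * suc (suc n * n) ∎
    where open ≡-Reasoning

suc-≤-double : ∀ t → suc (suc t) ≤ 2 * suc t
suc-≤-double t = ≤-trans (s≤s (s≤s (m≤m+n t t))) (≤-reflexive (double t))
  where
  double : ∀ t → suc (suc (t + t)) ≡ 2 * suc t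
  double = solve-∀

suc-^-≤ : ∀ t k → suc (suc t) ^ k ≤ 2 ^ k * suc t ^ k
suc-^-≤ t zero    = ≤-refl
suc-^-≤ t (suc k) = begin
  suc (suc t) * suc (suc t) ^ k    ≤⟨ *-mono-≤ (suc-≤-double t) (suc-^-≤ t k) ⟩
  2 * suc t * (2 ^ k * suc t ^ k)  ≡⟨ rearrange (suc t) (2 ^ k) (suc t ^ k) ⟩
  2 * 2 ^ k * (suc t * suc t ^ k)  ∎
  where
  open ≤-Reasoning
  rearrange : ∀ a b c → 2 * a * (b * c) ≡ 2 * b * (a * c)
  rearrange = solve-∀

levi-size-≤ : ∀ t → 2 * suc (suc (suc t) * suc t) ≤ 6 * (suc t * suc t)
levi-size-≤ t = ≤-trans (m≤m+n _ (4 * (t * t) + 6 * t)) (≤-reflexive (identity t))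
  where
  identity : ∀ t → 2 * suc (suc (suc t) * suc t) + (4 * (t * t) + 6 * t) ≡ 6 * (suc t * suc t)
  identity = solve-∀

levi-error-≤ : ∀ t k → 2 * suc (suc (suc t) * suc t) * suc (suc t) ^ k ≤ 6 * 2 ^ k * suc t ^ (2 + k)
levi-error-≤ t k =
  ≤-trans (*-mono-≤ (levi-size-≤ t) (suc-^-≤ t k)) (≤-reflexive (rearrange (suc t) (2 ^ k) (suc t ^ k)))
  where
  rearrange : ∀ a b c → 6 * (a * a) * (b * c) ≡ 6 * b * (a * (a * c))
  rearrange = solve-∀

-- (n − 1)²(n + 1)(n² + n + 1) = (n² − 1)(n³ − 1) = n⁵ + 1 − (n³ + n²)
main-term-identity : ∀ t X →
  t * t * (2 * suc (suc (suc t) * suc t) * (suc (suc t) * X)) + 2 * (X * (suc t * (suc t * suc t) + suc t * suc t)) ≡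
  2 * (suc t * (suc t * (suc t * (suc t * (suc t * X))))) + 2 * X
main-term-identity = solve-∀

main-term-≤ : ∀ t X →
  t * t * (2 * suc (suc (suc t) * suc t) * (suc (suc t) * X)) ≤ 2 * (suc t * (suc t * (suc t * (suc t * (suc t * X)))))
main-term-≤ t X = +-cancelʳ-≤ (2 * X) _ _ (begin
  t * t * (2 * suc (suc (suc t) * suc t) * (suc (suc t) * X)) + 2 * X
    ≤⟨ +-monoʳ-≤ (t * t * (2 * suc (suc (suc t) * suc t) * (suc (suc t) * X)))
                 (*-monoʳ-≤ 2 (m≤m*n X (suc t * (suc t * suc t) + suc t * suc t))) ⟩
  t * t * (2 * suc (suc (suc t) * suc t) * (suc (suc t) * X)) + 2 * (X * (suc t * (suc t * suc t) + suc t * suc t))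
    ≡⟨ main-term-identity t X ⟩
  2 * (suc t * (suc t * (suc t * (suc t * (suc t * X))))) + 2 * X ∎)
  where open ≤-Reasoning

main-term-≥ : ∀ t X →
  2 * (suc t * (suc t * (suc t * (suc t * (suc t * X))))) ≤
  t * t * (2 * suc (suc (suc t) * suc t) * (suc (suc t) * X)) + 4 * (suc t * (suc t * (suc t * X)))
main-term-≥ t X = begin
  2 * (suc t * (suc t * (suc t * (suc t * (suc t * X)))))
    ≤⟨ m≤m+n _ (2 * X) ⟩
  2 * (suc t * (suc t * (suc t * (suc t * (suc t * X))))) + 2 * X
    ≡⟨ main-term-identity t X ⟨
  t * t * (2 * suc (suc (suc t) * suc t) * (suc (suc t) * X)) + 2 * (X * (suc t * (suc t * suc t) + suc t * suc t))
    ≤⟨ +-monoʳ-≤ (t * t * (2 * suc (suc (suc t) * suc t) * (suc (suc t) * X)))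
                 (*-monoʳ-≤ 2 (*-monoʳ-≤ X (+-monoʳ-≤ (suc t * (suc t * suc t)) (m≤n*m (suc t * suc t) (suc t))))) ⟩
  t * t * (2 * suc (suc (suc t) * suc t) * (suc (suc t) * X)) + 2 * (X * (suc t * (suc t * suc t) + suc t * (suc t * suc t)))
    ≡⟨ cong (t * t * (2 * suc (suc (suc t) * suc t) * (suc (suc t) * X)) +_) (double-cube (suc t) X) ⟩
  t * t * (2 * suc (suc (suc t) * suc t) * (suc (suc t) * X)) + 4 * (suc t * (suc t * (suc t * X))) ∎
  where
  open ≤-Reasoning
  double-cube : ∀ a X → 2 * (X * (a * (a * a) + a * (a * a))) ≡ 4 * (a * (a * (a * X)))
  double-cube = solve-∀

-- c[ M ]Levi is a floor quotient: M ⌊S / 2M⌋ is S / 2 up to an error below M.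
/-≤ : ∀ m S A → S ≤ 2 * A → suc m * (S / (2 * suc m)) ≤ A
/-≤ m S A S≤2A = *-cancelˡ-≤ 2 (begin
  2 * (suc m * q)   ≡⟨ rearrange m q ⟩
  q * (2 * suc m)   ≤⟨ m/n*n≤m S (2 * suc m) ⟩
  S                 ≤⟨ S≤2A ⟩
  2 * A             ∎)
  where
  open ≤-Reasoning
  q : ℕ
  q = S / (2 * suc m)
  rearrange : ∀ m q → 2 * (suc m * q) ≡ q * (2 * suc m)
  rearrange = solve-∀

/-≥ : ∀ m S B E → 2 * B ≤ S + E → B ≤ suc m * (S / (2 * suc m)) + (suc m + E)
/-≥ m S B E 2B≤S+E = *-cancelˡ-≤ 2 (begin
  2 * B
    ≤⟨ 2B≤S+E ⟩
  S + E
    ≤⟨ +-mono-≤ S≤ (m≤m+n E (E + 0)) ⟩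
  2 * suc m + q * (2 * suc m) + 2 * E
    ≡⟨ rearrange m q E ⟩
  2 * (suc m * q + (suc m + E)) ∎)
  where
  open ≤-Reasoning
  q : ℕ
  q = S / (2 * suc m)
  S≤ : S ≤ 2 * suc m + q * (2 * suc m)
  S≤ = ≤-trans (≤-reflexive (m≡m%n+[m/n]*n S (2 * suc m))) (+-monoˡ-≤ _ (<⇒≤ (m%n<n S (2 * suc m))))
  rearrange : ∀ m q E → 2 * suc m + q * (2 * suc m) + 2 * E ≡ 2 * (suc m * q + (suc m + E))
  rearrange = solve-∀

errorConstant : ℕ → ℕ
errorConstant r = 6 * 2 ^ (3 + r)

repeatConstant : ℕ → ℕ
repeatConstant r = (7 + r) * ((7 + r) * errorConstant r) + 6 * 2 ^ (1 + r) + 4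

cycleConstant : ℕ → ℕ
cycleConstant r = errorConstant r + (7 + r + repeatConstant r)

module _ {p l : ℕ} (Π : ProjectivePlane p l) (t : ℕ) (order : HasOrder Π (suc t)) where

  open LeviGraph Π (suc t) order

  levi-cycleSeqs-≤ : ∀ r → cycleSeqs (7 + r) ≤ 2 * (suc t ^ (7 + r) + errorConstant r * suc t ^ (5 + r))
  levi-cycleSeqs-≤ r = begin
    cycleSeqs (7 + r)
      ≤⟨ cycleSeqs-≤ r ⟩
    t * t * (v * (suc (suc t) * suc t ^ (r + 2))) + 2 * (v * suc (suc t) ^ (3 + r))
      ≡⟨ cong₂ (λ V e → t * t * (V * (suc (suc t) * suc t ^ e)) + 2 * (V * suc (suc t) ^ (3 + r)))
               levi-size (+-comm r 2) ⟩
    t * t * (2 * suc (suc (suc t) * suc t) * (suc (suc t) * suc t ^ (2 + r))) +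
    2 * (2 * suc (suc (suc t) * suc t) * suc (suc t) ^ (3 + r))
      ≤⟨ +-mono-≤ (main-term-≤ t (suc t ^ (2 + r))) (*-monoʳ-≤ 2 (levi-error-≤ t (3 + r))) ⟩
    2 * suc t ^ (7 + r) + 2 * (errorConstant r * suc t ^ (5 + r))
      ≡⟨ *-distribˡ-+ 2 (suc t ^ (7 + r)) (errorConstant r * suc t ^ (5 + r)) ⟨
    2 * (suc t ^ (7 + r) + errorConstant r * suc t ^ (5 + r)) ∎
    where open ≤-Reasoning

  levi-cycleSeqs-≥ : ∀ j → let r = suc (j + j) in
    2 * suc t ^ (7 + r) ≤ cycleSeqs (7 + r) + repeatConstant r * suc t ^ (5 + r)
  levi-cycleSeqs-≥ j = begin
    2 * suc t ^ (7 + r)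
      ≤⟨ main-term-≥ t (suc t ^ (2 + r)) ⟩
    t * t * (V₀ * (suc (suc t) * suc t ^ (2 + r))) + 4 * suc t ^ (5 + r)
      ≡⟨ cong₂ (λ V e → t * t * (V * (suc (suc t) * suc t ^ e)) + 4 * suc t ^ (5 + r))
               (sym levi-size) (+-comm 2 r) ⟩
    t * t * (v * (suc (suc t) * suc t ^ (r + 2))) + 4 * suc t ^ (5 + r)
      ≤⟨ +-monoˡ-≤ _ (cycleSeqs-≥ {j} refl) ⟩
    cycleSeqs M + M * (M * (v * suc (suc t) ^ (3 + r))) + t * t * (v * suc (suc t) ^ (1 + r)) + 4 * suc t ^ (5 + r)
      ≡⟨ cong (λ V → cycleSeqs M + M * (M * (V * suc (suc t) ^ (3 + r))) + t * t * (V * suc (suc t) ^ (1 + r)) +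
                     4 * suc t ^ (5 + r)) levi-size ⟩
    cycleSeqs M + M * (M * (V₀ * suc (suc t) ^ (3 + r))) + t * t * (V₀ * suc (suc t) ^ (1 + r)) + 4 * suc t ^ (5 + r)
      ≤⟨ +-monoˡ-≤ _ (+-mono-≤ (+-monoʳ-≤ (cycleSeqs M) (*-monoʳ-≤ M (*-monoʳ-≤ M (levi-error-≤ t (3 + r)))))
                               short-walks) ⟩
    cycleSeqs M + M * (M * (errorConstant r * suc t ^ (5 + r))) + 6 * 2 ^ (1 + r) * suc t ^ (5 + r) + 4 * suc t ^ (5 + r)
      ≡⟨ collect (cycleSeqs M) M (errorConstant r) (6 * 2 ^ (1 + r)) (suc t ^ (5 + r)) ⟩
    cycleSeqs M + repeatConstant r * suc t ^ (5 + r) ∎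
    where
    open ≤-Reasoning
    r M V₀ : ℕ
    r = suc (j + j)
    M = 7 + r
    V₀ = 2 * suc (suc (suc t) * suc t)
    short-walks : t * t * (V₀ * suc (suc t) ^ (1 + r)) ≤ 6 * 2 ^ (1 + r) * suc t ^ (5 + r)
    short-walks = begin
      t * t * (V₀ * suc (suc t) ^ (1 + r))
        ≤⟨ *-mono-≤ (*-mono-≤ (n≤1+n t) (n≤1+n t)) (levi-error-≤ t (1 + r)) ⟩
      suc t * suc t * (6 * 2 ^ (1 + r) * suc t ^ (3 + r))
        ≡⟨ rearrange (suc t) (6 * 2 ^ (1 + r)) (suc t ^ (3 + r)) ⟩
      6 * 2 ^ (1 + r) * suc t ^ (5 + r) ∎
      where
      rearrange : ∀ a K Y → a * a * (K * Y) ≡ K * (a * (a * Y))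
      rearrange = solve-∀
    collect : ∀ S M K K′ Y → S + M * (M * (K * Y)) + K′ * Y + 4 * Y ≡ S + (M * (M * K) + K′ + 4) * Y
    collect = solve-∀

CycleBounds : ℕ → ∀ {p l} → ProjectivePlane p l → ℕ → ℕ → Set
CycleBounds C Π n M = (M * c[ M ]Levi Π ≤ n ^ M + C * n ^ (M ∸ 2)) × (n ^ M ≤ M * c[ M ]Levi Π + C * n ^ (M ∸ 2))

levi-cycleBounds : ∀ j {p l} (Π : ProjectivePlane p l) t → HasOrder Π (suc t) →
                   CycleBounds (cycleConstant (suc (j + j))) Π (suc t) (7 + suc (j + j))
levi-cycleBounds j Π t order = upper , lower
  where
  open LeviGraph Π (suc t) order using (cycleSeqCount≡cycleSeqs)
  r M K C S Y : ℕ
  r = suc (j + j)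
  M = 7 + r
  K = errorConstant r
  C = cycleConstant r
  S = cycleSeqCount (leviVertices _ _) eqV (leviAdj Π) M
  Y = suc t ^ (5 + r)
  upper : M * c[ M ]Levi Π ≤ suc t ^ M + C * Y
  upper = ≤-trans (/-≤ (6 + r) S _ (subst (_≤ 2 * (suc t ^ M + K * Y)) (sym (cycleSeqCount≡cycleSeqs M))
                                          (levi-cycleSeqs-≤ Π t order r)))
                  (+-monoʳ-≤ (suc t ^ M) (*-monoˡ-≤ Y (m≤m+n K _)))
  lower : suc t ^ M ≤ M * c[ M ]Levi Π + C * Y
  lower = ≤-trans (/-≥ (6 + r) S (suc t ^ M) _ (subst (λ s → 2 * suc t ^ M ≤ s + _) (sym (cycleSeqCount≡cycleSeqs M))
                                                       (levi-cycleSeqs-≥ Π t order j)))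
                  (+-monoʳ-≤ (M * c[ M ]Levi Π) (begin
                    M + repeatConstant r * Y      ≤⟨ +-monoˡ-≤ _ (m≤m*n M Y ⦃ m^n≢0 (suc t) (5 + r) ⦄) ⟩
                    M * Y + repeatConstant r * Y  ≡⟨ *-distribʳ-+ Y M (repeatConstant r) ⟨
                    (M + repeatConstant r) * Y    ≤⟨ *-monoˡ-≤ Y (m≤n+m _ K) ⟩
                    C * Y                         ∎))
    where open ≤-Reasoning

theorem1 : ∀ (k : ℕ) → 4 ≤ k →
    ∃[ C ] ∃[ N ] ∀ (n p l : ℕ) (Π : ProjectivePlane p l) → HasOrder Π n → N ≤ n →
    ((2 * k) * c[ 2 * k ]Levi Π ≤ n ^ (2 * k) + C * n ^ (2 * k ∸ 2))
    × (n ^ (2 * k) ≤ (2 * k) * c[ 2 * k ]Levi Π + C * n ^ (2 * k ∸ 2))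
theorem1 (suc (suc (suc (suc j)))) (s≤s (s≤s (s≤s (s≤s z≤n)))) = C , 1 , bounds
  where
  C : ℕ
  C = cycleConstant (suc (j + j))
  2k≡7+r : ∀ j → 2 * (4 + j) ≡ 7 + suc (j + j)
  2k≡7+r = solve-∀
  bounds : ∀ n p l (Π : ProjectivePlane p l) → HasOrder Π n → 1 ≤ n → CycleBounds C Π n (2 * (4 + j))
  bounds (suc t) p l Π order _ = subst (CycleBounds C Π (suc t)) (sym (2k≡7+r j)) (levi-cycleBounds j Π t order)
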